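{- Let $1\le k<n$ and let $\Delta(k,n)=\{x\in[0,1]^n:\sum_{i=1}^n x_i=k\}$. Let $A_1\sqcup A_2\sqcup A_3=[n]$ be a partition and $\mu_1,\mu_2,\mu_3\in\mathbb N$ with $\mu_1+\mu_2+\mu_3=k$ and $1\le\mu_j\le|A_j|-1$ for $j=1,2,3$. Consider the two subdivisions of $\Delta(k,n)$ whose maximal cells are, respectively, $P_1=\{x\in\Delta(k,n):\sum_{i\in A_3}x_i\le\mu_3,\ \sum_{i\in A_2}x_i\ge\mu_2\}$, $P_2=\{x\in\Delta(k,n):\sum_{i\in A_1}x_i\le\mu_1,\ \sum_{i\in A_3}x_i\ge\mu_3\}$, $P_3=\{x\in\Delta(k,n):\sum_{i\in A_2}x_i\le\mu_2,\ \sum_{i\in A_1}x_i\ge\mu_1\}$, and the same three sets with every "$\le$" replaced by "$\ge$" and vice versa. (These are $3$-splits of $\Delta(k,n)$.) Both of these subdivisions are matroid subdivisions, i.e. every cell of them is a matroid polytope.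
   Context: $[n]=\{1,\dots,n\}$. For a matroid $\mathcal M$ on $[n]$, its matroid polytope is the convex hull of the characteristic vectors in $\mathbb R^n$ of the bases of $\mathcal M$. A subdivision of the polytope $\Delta(k,n)$ is a polyhedral subdivision using only vertices of $\Delta(k,n)$ (the 0/1-vectors with exactly $k$ ones); it is a matroid subdivision if all of its cells are matroid polytopes. A $3$-split of a polytope is a coarsest subdivision (one admitting no non-trivial coarsening other than itself) with exactly $3$ maximal cells having an interior face of codimension $2$.
   Formalization: Points of the cells and of the matroid polytopes lie in ℚ^n rather than ℝ^n, and the faces of each cell are those maximizing linear functionals with rational coefficients. -}

module Defs where

open import Data.Nat as ℕ using (ℕ; zero; suc)
open import Data.Bool using (Bool; true; false; if_then_else_)
open import Data.Fin using (Fin; zero; suc; _≟_)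
open import Relation.Nullary using (yes; no)
open import Data.Fin.Subset using (Subset; _∈_; _∉_; _-_; _∪_; ⁅_⁆)
open import Data.Vec using (lookup)
open import Data.Integer using (+_)
open import Data.Rational using (ℚ; 0ℚ; 1ℚ; _+_; _*_; _≤_; _/_)
open import Data.List using (List; []; _∷_)
open import Data.Product using (Σ; ∃; _×_; _,_)
open import Relation.Binary.PropositionalEquality using (_≡_)

Point : ℕ → Set
Point n = Fin n → ℚ

ℕ→ℚ : ℕ → ℚ
ℕ→ℚ m = + m / 1

sumFin : {n : ℕ} → (Fin n → ℚ) → ℚ
sumFin {zero} f = 0ℚ
sumFin {suc n} f = f zero + sumFin (λ i → f (suc i))

sumOver : {n : ℕ} → (Fin n → Bool) → Point n → ℚ
sumOver A x = sumFin (λ i → if A i then x i else 0ℚ)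

InHypersimplex : (k n : ℕ) → Point n → Set
InHypersimplex k n x = ((i : Fin n) → (0ℚ ≤ x i) × (x i ≤ 1ℚ)) × (sumFin x ≡ ℕ→ℚ k)

χ : {n : ℕ} → Subset n → Point n
χ B i = if lookup B i then 1ℚ else 0ℚ

record Matroid (n : ℕ) : Set₁ where
  field
    IsBasis  : Subset n → Set
    nonempty : ∃ λ B → IsBasis B
    exchange : ∀ B₁ B₂ → IsBasis B₁ → IsBasis B₂ →
               ∀ e → e ∈ B₁ → e ∉ B₂ →
               ∃ λ f → f ∈ B₂ × f ∉ B₁ × IsBasis ((B₁ - e) ∪ ⁅ f ⁆)

combo : {n : ℕ} → List (ℚ × Subset n) → Point n
combo [] i = 0ℚ
combo ((c , B) ∷ l) i = c * χ B i + combo l i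

coeffSum : {n : ℕ} → List (ℚ × Subset n) → ℚ
coeffSum [] = 0ℚ
coeffSum ((c , B) ∷ l) = c + coeffSum l

data AllTerms {n : ℕ} (P : ℚ → Subset n → Set) : List (ℚ × Subset n) → Set where
  []  : AllTerms P []
  _∷_ : ∀ {c B l} → P c B → AllTerms P l → AllTerms P ((c , B) ∷ l)

InMatroidPolytope : {n : ℕ} → Matroid n → Point n → Set
InMatroidPolytope {n} M x =
  Σ (List (ℚ × Subset n)) λ l →
    AllTerms (λ c B → (0ℚ ≤ c) × Matroid.IsBasis M B) l ×
    (coeffSum l ≡ 1ℚ) × ((i : Fin n) → combo l i ≡ x i)

-- a set of points (rational points of a rational polytope) is a matroid polytope
IsMatroidPolytope : {n : ℕ} → (Point n → Set) → Set₁
IsMatroidPolytope {n} P =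
  Σ (Matroid n) λ M → (x : Point n) → (P x → InMatroidPolytope M x) × (InMatroidPolytope M x → P x)

dot : {n : ℕ} → Point n → Point n → ℚ
dot c x = sumFin (λ i → c i * x i)

face : {n : ℕ} → (Point n → Set) → Point n → (Point n → Set)
face {n} P c x = P x × ((y : Point n) → P y → dot c y ≤ dot c x)

-- partition of [n] into three blocks: block label of each element
blockSet : {n : ℕ} → (Fin n → Fin 3) → Fin 3 → (Fin n → Bool)
blockSet lab j i with lab i ≟ j
... | yes _ = true
... | no _ = false

blockSize : {n : ℕ} → (Fin n → Fin 3) → Fin 3 → ℕ
blockSize {zero} lab j = 0
blockSize {suc n} lab j =
  (if blockSet lab j zero then 1 else 0) ℕ.+ blockSize (λ i → lab (suc i)) j

j₁ j₂ j₃ : Fin 3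
j₁ = zero
j₂ = suc zero
j₃ = suc (suc zero)

-- the three maximal cells of the first subdivision:
-- P_j = { x ∈ Δ(k,n) : Σ_{A_{j-1}} x ≤ μ_{j-1}, Σ_{A_{j+1}} x ≥ μ_{j+1} } (indices mod 3)
-- flipped = true gives the second subdivision (≤ and ≥ exchanged)
halfspace : {n : ℕ} → Bool → (Fin n → Bool) → ℕ → Point n → Set
halfspace false A m x = sumOver A x ≤ ℕ→ℚ m
halfspace true  A m x = ℕ→ℚ m ≤ sumOver A x

prevIdx nextIdx : Fin 3 → Fin 3
prevIdx zero = j₃
prevIdx (suc zero) = j₁
prevIdx (suc (suc zero)) = j₂
nextIdx zero = j₂
nextIdx (suc zero) = j₃
nextIdx (suc (suc zero)) = j₁

cell : (k n : ℕ) → (Fin n → Fin 3) → (Fin 3 → ℕ) → Bool → Fin 3 → Point n → Set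
cell k n lab μ flipped j x =
  InHypersimplex k n x ×
  halfspace flipped (blockSet lab (prevIdx j)) (μ (prevIdx j)) x ×
  halfspace (Data.Bool.not flipped) (blockSet lab (nextIdx j)) (μ (nextIdx j)) x

-- Each cell is the part of Δ(k,n) cut out by block bounds ℓ Y ≤ Σ_{i ∈ A_Y} x i ≤ h Y: one block
-- is bounded above by its μ, another below by its μ, and the remaining bounds are the trivial
-- 0 and k. Its 0/1 points are the k-sets B with ℓ Y ≤ |B ∩ A_Y| ≤ h Y, and a counting argument
-- shows that they satisfy symmetric basis exchange. Every rational point x of the cell is an
-- average of such sets: write D x = y with y ∈ ℕⁿ, lay the integers y i of each block end to end
-- on ℕ, and let the r-th set consist of the i whose interval contains a number ≡ r (mod D); it
-- meets A_Y in ⌊s/D⌋ or ⌈s/D⌉ elements, where s = Σ_{i ∈ A_Y} y i. Finally, if a polytope is the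
-- convex hull of a family with symmetric exchange, the members maximising a linear functional c
-- still have the exchange property and span the face in direction c.

module Submission where

open import Defs
open import Data.Nat using (ℕ)
open import Data.Fin using (Fin)

module ℕ→ℚ-Properties where

  open import Data.Nat as ℕ using (ℕ; zero; suc)
  import Data.Nat.Properties as ℕP
  open import Data.Nat.Coprimality using (Coprime; 1-coprimeTo)
  import Data.Nat.Coprimality as Coprimality
  open import Data.Integer as ℤ using (+_; -[1+_])
  import Data.Integer.Properties as ℤP
  open import Data.Rational as ℚ using (ℚ; mkℚ; 0ℚ; _+_; _*_; _≤_)
  import Data.Rational.Properties as ℚP
  import Data.Rational.Unnormalised as ℚᵘ
  import Data.Rational.Unnormalised.Properties as ℚᵘP
  open import Data.Fin using (Fin; zero; suc)
  open import Data.Product using (Σ; _,_)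
  open import Relation.Binary.PropositionalEquality
    using (_≡_; cong; cong₂; sym; trans; subst₂; module ≡-Reasoning)

  ℕ→ℚ≡mkℚ : ∀ m → ℕ→ℚ m ≡ mkℚ (+ m) 0 (Coprimality.sym (1-coprimeTo m))
  ℕ→ℚ≡mkℚ m = ℚP.normalize-coprime (Coprimality.sym (1-coprimeTo m))

  ℕ→ℚ-homo-+ : ∀ m n → ℕ→ℚ (m ℕ.+ n) ≡ ℕ→ℚ m + ℕ→ℚ n
  ℕ→ℚ-homo-+ m n = ℚP.toℚᵘ-injective
    (ℚᵘP.≃-trans unnormalised (ℚᵘP.≃-sym (ℚP.toℚᵘ-homo-+ (ℕ→ℚ m) (ℕ→ℚ n))))
    where
    unnormalised : ℚ.toℚᵘ (ℕ→ℚ (m ℕ.+ n)) ℚᵘ.≃ (ℚ.toℚᵘ (ℕ→ℚ m) ℚᵘ.+ ℚ.toℚᵘ (ℕ→ℚ n))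
    unnormalised rewrite ℕ→ℚ≡mkℚ (m ℕ.+ n) | ℕ→ℚ≡mkℚ m | ℕ→ℚ≡mkℚ n = ℚᵘ.*≡* (cong (ℤ._* + 1)
      (trans (ℤP.pos-+ m n) (sym (cong₂ ℤ._+_ (ℤP.*-identityʳ (+ m)) (ℤP.*-identityʳ (+ n))))))

  ℕ→ℚ-homo-* : ∀ m n → ℕ→ℚ (m ℕ.* n) ≡ ℕ→ℚ m * ℕ→ℚ n
  ℕ→ℚ-homo-* m n = ℚP.toℚᵘ-injective
    (ℚᵘP.≃-trans unnormalised (ℚᵘP.≃-sym (ℚP.toℚᵘ-homo-* (ℕ→ℚ m) (ℕ→ℚ n))))
    where
    unnormalised : ℚ.toℚᵘ (ℕ→ℚ (m ℕ.* n)) ℚᵘ.≃ (ℚ.toℚᵘ (ℕ→ℚ m) ℚᵘ.* ℚ.toℚᵘ (ℕ→ℚ n))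
    unnormalised rewrite ℕ→ℚ≡mkℚ (m ℕ.* n) | ℕ→ℚ≡mkℚ m | ℕ→ℚ≡mkℚ n =
      ℚᵘ.*≡* (cong (ℤ._* + 1) (ℤP.pos-* m n))

  ℕ→ℚ-mono-≤ : ∀ {m n} → m ℕ.≤ n → ℕ→ℚ m ≤ ℕ→ℚ n
  ℕ→ℚ-mono-≤ {m} {n} m≤n rewrite ℕ→ℚ≡mkℚ m | ℕ→ℚ≡mkℚ n =
    ℚ.*≤* (subst₂ ℤ._≤_ (sym (ℤP.*-identityʳ (+ m))) (sym (ℤP.*-identityʳ (+ n))) (ℤ.+≤+ m≤n))

  ℕ→ℚ-cancel-≤ : ∀ {m n} → ℕ→ℚ m ≤ ℕ→ℚ n → m ℕ.≤ n
  ℕ→ℚ-cancel-≤ {m} {n} m≤n rewrite ℕ→ℚ≡mkℚ m | ℕ→ℚ≡mkℚ n with m≤n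
  ... | ℚ.*≤* p = ℤP.drop‿+≤+ (subst₂ ℤ._≤_ (ℤP.*-identityʳ (+ m)) (ℤP.*-identityʳ (+ n)) p)

  ℕ→ℚ-injective : ∀ {m n} → ℕ→ℚ m ≡ ℕ→ℚ n → m ≡ n
  ℕ→ℚ-injective m≡n = ℕP.≤-antisym (ℕ→ℚ-cancel-≤ (ℚP.≤-reflexive m≡n))
                                   (ℕ→ℚ-cancel-≤ (ℚP.≤-reflexive (sym m≡n)))

  mkℚ-*-denominator : ∀ a d-1 .(c : Coprime a (suc d-1)) → mkℚ (+ a) d-1 c * ℕ→ℚ (suc d-1) ≡ ℕ→ℚ a
  mkℚ-*-denominator a d-1 c = ℚP.toℚᵘ-injective
    (ℚᵘP.≃-trans (ℚP.toℚᵘ-homo-* (mkℚ (+ a) d-1 c) (ℕ→ℚ (suc d-1))) unnormalised)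
    where
    open ≡-Reasoning
    unnormalised : (ℚ.toℚᵘ (mkℚ (+ a) d-1 c) ℚᵘ.* ℚ.toℚᵘ (ℕ→ℚ (suc d-1))) ℚᵘ.≃ ℚ.toℚᵘ (ℕ→ℚ a)
    unnormalised rewrite ℕ→ℚ≡mkℚ (suc d-1) | ℕ→ℚ≡mkℚ a = ℚᵘ.*≡* (begin
      (+ a ℤ.* + suc d-1) ℤ.* + 1 ≡⟨ ℤP.*-identityʳ _ ⟩
      + a ℤ.* + suc d-1           ≡⟨ cong (λ d → + a ℤ.* + d) (sym (ℕP.*-identityʳ (suc d-1))) ⟩
      + a ℤ.* + (suc d-1 ℕ.* 1)   ∎)

  nonNegative-*-denominator : (q : ℚ) → 0ℚ ≤ q → Σ ℕ λ a → q * ℕ→ℚ (suc (ℚ.denominator-1 q)) ≡ ℕ→ℚ a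
  nonNegative-*-denominator (mkℚ (+ a) d-1 c) _ = a , mkℚ-*-denominator a d-1 c
  nonNegative-*-denominator (mkℚ -[1+ a ] d-1 c) 0≤q with ℚ.nonNegative 0≤q
  ... | ()

  *-ℕ→ℚ-rescale : ∀ (q : ℚ) d e a → q * ℕ→ℚ d ≡ ℕ→ℚ a → q * ℕ→ℚ (d ℕ.* e) ≡ ℕ→ℚ (a ℕ.* e)
  *-ℕ→ℚ-rescale q d e a qd≡a = begin
    q * ℕ→ℚ (d ℕ.* e)         ≡⟨ cong (q *_) (ℕ→ℚ-homo-* d e) ⟩
    q * (ℕ→ℚ d * ℕ→ℚ e)       ≡⟨ sym (ℚP.*-assoc q _ _) ⟩
    q * ℕ→ℚ d * ℕ→ℚ e         ≡⟨ cong (_* ℕ→ℚ e) qd≡a ⟩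
    ℕ→ℚ a * ℕ→ℚ e             ≡⟨ sym (ℕ→ℚ-homo-* a e) ⟩
    ℕ→ℚ (a ℕ.* e)             ∎
    where open ≡-Reasoning

  clearDenominators : ∀ {n} (x : Point n) → (∀ i → 0ℚ ≤ x i) →
    Σ ℕ λ D-1 → Σ (Fin n → ℕ) λ y → ∀ i → x i * ℕ→ℚ (suc D-1) ≡ ℕ→ℚ (y i)
  clearDenominators {zero} x _ = 0 , (λ ()) , (λ ())
  clearDenominators {suc n} x 0≤x
    with clearDenominators (λ i → x (suc i)) (λ i → 0≤x (suc i))
       | nonNegative-*-denominator (x zero) (0≤x zero)
  ... | D-1 , y , xD≡y | a , x₀d≡a = D-1 ℕ.+ d-1 ℕ.* suc D-1 , y′ , x*D′≡y′
    where
    d-1 = ℚ.denominator-1 (x zero)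
    y′ : Fin (suc n) → ℕ
    y′ zero = a ℕ.* suc D-1
    y′ (suc i) = y i ℕ.* suc d-1
    x*D′≡y′ : ∀ i → x i * ℕ→ℚ (suc d-1 ℕ.* suc D-1) ≡ ℕ→ℚ (y′ i)
    x*D′≡y′ zero = *-ℕ→ℚ-rescale (x zero) (suc d-1) (suc D-1) a x₀d≡a
    x*D′≡y′ (suc i) = trans (cong (λ D → x (suc i) * ℕ→ℚ D) (ℕP.*-comm (suc d-1) (suc D-1)))
                            (*-ℕ→ℚ-rescale (x (suc i)) (suc D-1) (suc d-1) (y i) (xD≡y i))

module FiniteSums where

  open ℕ→ℚ-Properties
  open import Data.Nat as ℕ using (ℕ; zero; suc)
  import Data.Nat.Properties as ℕP
  open import Data.Bool using (Bool; true; false; if_then_else_)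
  open import Data.Rational using (ℚ; 0ℚ; _+_; _*_; _≤_)
  import Data.Rational.Properties as ℚP
  open import Data.Fin as Fin using (Fin; zero; suc)
  open import Algebra.Bundles using (CommutativeMonoid)
  open import Algebra.Properties.CommutativeSemigroup
    (CommutativeMonoid.commutativeSemigroup ℚP.+-0-commutativeMonoid) using (interchange)
  open import Algebra.Properties.Semiring.Sum ℕP.+-*-semiring using (sum; sum-cong-≗)
  open import Relation.Nullary using (yes; no)
  open import Relation.Nullary.Decidable using (⌊_⌋)
  open import Data.Nat.Solver using (module +-*-Solver)
  open +-*-Solver using (solve; _:+_; _:=_)
  open import Data.Empty using (⊥-elim)
  open import Relation.Binary.PropositionalEquality
    using (_≡_; _≢_; refl; cong; cong₂; sym; trans; subst; module ≡-Reasoning)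

  sumFin-cong : ∀ {n} {f g : Fin n → ℚ} → (∀ i → f i ≡ g i) → sumFin f ≡ sumFin g
  sumFin-cong {zero} f≗g = refl
  sumFin-cong {suc n} f≗g = cong₂ _+_ (f≗g zero) (sumFin-cong (λ i → f≗g (suc i)))

  sumFin-+ : ∀ {n} (f g : Fin n → ℚ) → sumFin (λ i → f i + g i) ≡ sumFin f + sumFin g
  sumFin-+ {zero} f g = refl
  sumFin-+ {suc n} f g rewrite sumFin-+ (λ i → f (suc i)) (λ i → g (suc i)) =
    interchange (f zero) (g zero) (sumFin (λ i → f (suc i))) (sumFin (λ i → g (suc i)))

  sumFin-*ˡ : ∀ {n} (c : ℚ) (f : Fin n → ℚ) → sumFin (λ i → c * f i) ≡ c * sumFin f
  sumFin-*ˡ {zero} c f = sym (ℚP.*-zeroʳ c)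
  sumFin-*ˡ {suc n} c f rewrite sumFin-*ˡ c (λ i → f (suc i)) = sym (ℚP.*-distribˡ-+ c (f zero) _)

  sumFin-mono-≤ : ∀ {n} {f g : Fin n → ℚ} → (∀ i → f i ≤ g i) → sumFin f ≤ sumFin g
  sumFin-mono-≤ {zero} f≤g = ℚP.≤-refl
  sumFin-mono-≤ {suc n} f≤g = ℚP.+-mono-≤ (f≤g zero) (sumFin-mono-≤ (λ i → f≤g (suc i)))

  sumFin-zero : ∀ n → sumFin {n} (λ _ → 0ℚ) ≡ 0ℚ
  sumFin-zero zero = refl
  sumFin-zero (suc n) = cong (0ℚ +_) (sumFin-zero n)

  sumFin-ℕ→ℚ : ∀ {n} (f : Fin n → ℕ) → sumFin (λ i → ℕ→ℚ (f i)) ≡ ℕ→ℚ (sum f)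
  sumFin-ℕ→ℚ {zero} f = refl
  sumFin-ℕ→ℚ {suc n} f rewrite sumFin-ℕ→ℚ (λ i → f (suc i)) = sym (ℕ→ℚ-homo-+ (f zero) _)

  Bool→ℕ : Bool → ℕ
  Bool→ℕ b = if b then 1 else 0

  count : ∀ {n} → (Fin n → Bool) → ℕ
  count p = sum (λ i → Bool→ℕ (p i))

  count-cong : ∀ {n} {p q : Fin n → Bool} → (∀ i → p i ≡ q i) → count p ≡ count q
  count-cong {zero} p≗q = refl
  count-cong {suc n} p≗q = cong₂ ℕ._+_ (cong Bool→ℕ (p≗q zero)) (count-cong (λ i → p≗q (suc i)))

  restrict : ∀ {n} → (Fin n → Bool) → (Fin n → ℕ) → Fin n → ℕ
  restrict A f i = if A i then f i else 0

  Σ₃ : (Fin 3 → ℕ) → ℕ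
  Σ₃ g = g j₁ ℕ.+ g j₂ ℕ.+ g j₃

  Σ₃-insert : ∀ X a (g : Fin 3 → ℕ) → a ℕ.+ Σ₃ g ≡ Σ₃ (λ Y → (if ⌊ X Fin.≟ Y ⌋ then a else 0) ℕ.+ g Y)
  Σ₃-insert zero a g =
    solve 4 (λ a x y z → a :+ (x :+ y :+ z) := a :+ x :+ y :+ z) refl a (g j₁) (g j₂) (g j₃)
  Σ₃-insert (suc zero) a g =
    solve 4 (λ a x y z → a :+ (x :+ y :+ z) := x :+ (a :+ y) :+ z) refl a (g j₁) (g j₂) (g j₃)
  Σ₃-insert (suc (suc zero)) a g =
    solve 4 (λ a x y z → a :+ (x :+ y :+ z) := x :+ y :+ (a :+ z)) refl a (g j₁) (g j₂) (g j₃)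

  blockSet-suc : ∀ {n} (lab : Fin (suc n) → Fin 3) Y i →
    blockSet (λ i → lab (suc i)) Y i ≡ blockSet lab Y (suc i)
  blockSet-suc lab Y i with lab (suc i) Fin.≟ Y
  ... | yes _ = refl
  ... | no _ = refl

  blockSet-≡ : ∀ {n} (lab : Fin n → Fin 3) {Y i} → lab i ≡ Y → blockSet lab Y i ≡ true
  blockSet-≡ lab {Y} {i} labᵢ≡Y with lab i Fin.≟ Y
  ... | yes _ = refl
  ... | no labᵢ≢Y = ⊥-elim (labᵢ≢Y labᵢ≡Y)

  blockSet-≢ : ∀ {n} (lab : Fin n → Fin 3) {Y i} → lab i ≢ Y → blockSet lab Y i ≡ false
  blockSet-≢ lab {Y} {i} labᵢ≢Y with lab i Fin.≟ Y
  ... | yes labᵢ≡Y = ⊥-elim (labᵢ≢Y labᵢ≡Y)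
  ... | no _ = refl

  blockSet-true : ∀ {n} (lab : Fin n → Fin 3) {Y i} → blockSet lab Y i ≡ true → lab i ≡ Y
  blockSet-true lab {Y} {i} inside with lab i Fin.≟ Y
  ... | yes labᵢ≡Y = labᵢ≡Y

  sum-partition : ∀ {n} (lab : Fin n → Fin 3) (f : Fin n → ℕ) →
    sum f ≡ Σ₃ (λ Y → sum (restrict (blockSet lab Y) f))
  sum-partition {zero} lab f = refl
  sum-partition {suc n} lab f = begin
    f zero ℕ.+ sum f′                               ≡⟨ cong (f zero ℕ.+_) (sum-partition lab′ f′) ⟩
    f zero ℕ.+ Σ₃ tailSum                           ≡⟨ Σ₃-insert (lab zero) (f zero) tailSum ⟩
    Σ₃ (λ Y → first Y ℕ.+ tailSum Y)                ≡⟨ cong₂ ℕ._+_ (cong₂ ℕ._+_ (split j₁) (split j₂)) (split j₃) ⟩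
    Σ₃ (λ Y → sum (restrict (blockSet lab Y) f))    ∎
    where
    open ≡-Reasoning
    lab′ = λ i → lab (suc i)
    f′ = λ i → f (suc i)
    tailSum : Fin 3 → ℕ
    tailSum Y = sum (restrict (blockSet lab′ Y) f′)
    first : Fin 3 → ℕ
    first Y = if ⌊ lab zero Fin.≟ Y ⌋ then f zero else 0
    split : ∀ Y → first Y ℕ.+ tailSum Y ≡ sum (restrict (blockSet lab Y) f)
    split Y = cong₂ ℕ._+_ head (sum-cong-≗ (λ i → cong (λ b → if b then f (suc i) else 0) (blockSet-suc lab Y i)))
      where
      head : first Y ≡ restrict (blockSet lab Y) f zero
      head with lab zero Fin.≟ Y
      ... | yes _ = refl
      ... | no _ = refl

  sumOver-scale : ∀ {n} (A : Fin n → Bool) (x : Point n) (d : ℚ) (y : Fin n → ℕ) →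
    (∀ i → x i * d ≡ ℕ→ℚ (y i)) → sumOver A x * d ≡ ℕ→ℚ (sum (restrict A y))
  sumOver-scale A x d y xd≡y = begin
    sumOver A x * d                              ≡⟨ ℚP.*-comm _ d ⟩
    d * sumOver A x                              ≡⟨ sumFin-*ˡ d (λ i → if A i then x i else 0ℚ) ⟨
    sumFin (λ i → d * (if A i then x i else 0ℚ)) ≡⟨ sumFin-cong pointwise ⟩
    sumFin (λ i → ℕ→ℚ (restrict A y i))          ≡⟨ sumFin-ℕ→ℚ (restrict A y) ⟩
    ℕ→ℚ (sum (restrict A y))                     ∎
    where
    open ≡-Reasoning
    pointwise : ∀ i → d * (if A i then x i else 0ℚ) ≡ ℕ→ℚ (restrict A y i)
    pointwise i with A i
    ... | true = trans (ℚP.*-comm d (x i)) (xd≡y i)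
    ... | false = ℚP.*-zeroʳ d

  sumOver-nonNegative : ∀ {n} (A : Fin n → Bool) {x : Point n} → (∀ i → 0ℚ ≤ x i) → 0ℚ ≤ sumOver A x
  sumOver-nonNegative {n} A {x} 0≤x = subst (_≤ sumOver A x) (sumFin-zero n) (sumFin-mono-≤ pointwise)
    where
    pointwise : ∀ i → 0ℚ ≤ (if A i then x i else 0ℚ)
    pointwise i with A i
    ... | true = 0≤x i
    ... | false = ℚP.≤-refl

  sumOver-≤-sumFin : ∀ {n} (A : Fin n → Bool) {x : Point n} → (∀ i → 0ℚ ≤ x i) → sumOver A x ≤ sumFin x
  sumOver-≤-sumFin A {x} 0≤x = sumFin-mono-≤ pointwise
    where
    pointwise : ∀ i → (if A i then x i else 0ℚ) ≤ x i
    pointwise i with A i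
    ... | true = ℚP.≤-refl
    ... | false = 0≤x i

module SubsetCounting where

  open ℕ→ℚ-Properties
  open FiniteSums
  open import Data.Nat as ℕ using (ℕ; zero; suc; _+_; _≤_; z≤n; s≤s)
  import Data.Nat.Properties as ℕP
  open import Data.Bool using (Bool; true; false; if_then_else_; _∧_; _∨_; not)
  import Data.Bool.Properties as BoolP
  open import Data.Rational using (0ℚ)
  open import Data.Fin as Fin using (Fin; zero; suc)
  import Data.Fin.Properties as FinP
  open import Data.Fin.Subset using (Subset; _∈_; _∉_; _─_; _∪_; ⁅_⁆) renaming (_-_ to _∖_)
  open import Data.Vec using ([]; _∷_; lookup)
  open import Relation.Nullary.Decidable using (⌊_⌋)
  open import Data.Vec.Properties using (lookup-zipWith; lookup-replicate; []=⇒lookup; lookup⇒[]=)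
  open import Data.Product using (Σ; _,_)
  open import Data.Empty using (⊥-elim)
  open import Relation.Nullary using (Dec; yes; no)
  open import Algebra.Properties.CommutativeSemigroup ℕP.+-commutativeSemigroup using (xy∙z≈xz∙y)
  open import Algebra.Properties.Semiring.Sum ℕP.+-*-semiring using (sum; sum-cong-≗)
  open import Relation.Binary.PropositionalEquality
    using (_≡_; _≢_; refl; cong; cong₂; sym; trans; module ≡-Reasoning)

  sizeIn : ∀ {n} → (Fin n → Bool) → Subset n → ℕ
  sizeIn A B = count (λ i → A i ∧ lookup B i)

  size : ∀ {n} → Subset n → ℕ
  size = sizeIn (λ _ → true)

  restrict-Bool→ℕ : ∀ {n} (A p : Fin n → Bool) i → restrict A (λ i → Bool→ℕ (p i)) i ≡ Bool→ℕ (A i ∧ p i)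
  restrict-Bool→ℕ A p i with A i
  ... | true = refl
  ... | false = refl

  count-partition : ∀ {n} (lab : Fin n → Fin 3) (p : Fin n → Bool) →
    count p ≡ Σ₃ (λ Y → count (λ i → blockSet lab Y i ∧ p i))
  count-partition lab p = trans (sum-partition lab (λ i → Bool→ℕ (p i)))
    (cong₂ _+_ (cong₂ _+_ (restricted j₁) (restricted j₂)) (restricted j₃))
    where
    restricted : ∀ Y → sum (restrict (blockSet lab Y) (λ i → Bool→ℕ (p i))) ≡ count (λ i → blockSet lab Y i ∧ p i)
    restricted Y = sum-cong-≗ (restrict-Bool→ℕ (blockSet lab Y) p)

  χ≡ℕ→ℚ∘Bool→ℕ : ∀ {n} (B : Subset n) i → χ B i ≡ ℕ→ℚ (Bool→ℕ (lookup B i))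
  χ≡ℕ→ℚ∘Bool→ℕ B i with lookup B i
  ... | true = refl
  ... | false = refl

  sumOver-χ : ∀ {n} (A : Fin n → Bool) (B : Subset n) → sumOver A (χ B) ≡ ℕ→ℚ (sizeIn A B)
  sumOver-χ A B = trans (sumFin-cong restricted) (sumFin-ℕ→ℚ (λ i → Bool→ℕ (A i ∧ lookup B i)))
    where
    restricted : ∀ i → (if A i then χ B i else 0ℚ) ≡ ℕ→ℚ (Bool→ℕ (A i ∧ lookup B i))
    restricted i with A i
    ... | true = χ≡ℕ→ℚ∘Bool→ℕ B i
    ... | false = refl

  count-pos : ∀ {n} (p : Fin n → Bool) i → p i ≡ true → 1 ≤ count p
  count-pos p zero pᵢ rewrite pᵢ = s≤s z≤n
  count-pos p (suc i) pᵢ = ℕP.≤-trans (count-pos (λ j → p (suc j)) i pᵢ) (ℕP.m≤n+m _ (Bool→ℕ (p zero)))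

  count-witness : ∀ {n} (p : Fin n → Bool) → 1 ≤ count p → Σ (Fin n) λ i → p i ≡ true
  count-witness {zero} p ()
  count-witness {suc n} p 1≤count with p zero in p₀
  ... | true = zero , p₀
  ... | false with count-witness (λ j → p (suc j)) 1≤count
  ...   | i , pᵢ = suc i , pᵢ

  count-split : ∀ {n} (A p q : Fin n → Bool) →
    count (λ i → A i ∧ p i) ≡ count (λ i → A i ∧ (p i ∧ q i)) + count (λ i → A i ∧ (p i ∧ not (q i)))
  count-split {zero} A p q = refl
  count-split {suc n} A p q rewrite count-split (λ i → A (suc i)) (λ i → p (suc i)) (λ i → q (suc i))
    with A zero | p zero | q zero
  ... | true | true | true = refl
  ... | true | true | false = sym (ℕP.+-suc _ _)
  ... | true | false | _ = refl
  ... | false | _ | _ = refl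

  count-∧-update : ∀ {n} (A p q : Fin n → Bool) e → p e ≡ true → q e ≡ false → (∀ i → i ≢ e → p i ≡ q i) →
    count (λ i → A i ∧ p i) ≡ count (λ i → A i ∧ q i) + Bool→ℕ (A e)
  count-∧-update {suc n} A p q zero pₑ qₑ p≗q
    rewrite pₑ | qₑ | count-cong {p = λ i → A (suc i) ∧ p (suc i)} {q = λ i → A (suc i) ∧ q (suc i)}
                        (λ i → cong (A (suc i) ∧_) (p≗q (suc i) (λ ())))
    with A zero
  ... | true = ℕP.+-comm 1 _
  ... | false = sym (ℕP.+-identityʳ _)
  count-∧-update {suc n} A p q (suc e) pₑ qₑ p≗q
    rewrite p≗q zero (λ ())
          | count-∧-update (λ i → A (suc i)) (λ i → p (suc i)) (λ i → q (suc i)) e pₑ qₑ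
                           (λ i i≢e → p≗q (suc i) (λ eq → i≢e (FinP.suc-injective eq))) =
    sym (ℕP.+-assoc (Bool→ℕ (A zero ∧ q zero)) _ _)

  lookup-⁅x⁆-x : ∀ {n} (x : Fin n) → lookup ⁅ x ⁆ x ≡ true
  lookup-⁅x⁆-x zero = refl
  lookup-⁅x⁆-x (suc x) = lookup-⁅x⁆-x x

  lookup-⁅x⁆-y : ∀ {n} {x y : Fin n} → y ≢ x → lookup ⁅ x ⁆ y ≡ false
  lookup-⁅x⁆-y {x = zero} {zero} y≢x = ⊥-elim (y≢x refl)
  lookup-⁅x⁆-y {x = zero} {suc y} _ = lookup-replicate y false
  lookup-⁅x⁆-y {x = suc x} {zero} _ = refl
  lookup-⁅x⁆-y {x = suc x} {suc y} y≢x = lookup-⁅x⁆-y (λ y≡x → y≢x (cong suc y≡x))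

  lookup-─-inside : ∀ {n} (p q : Subset n) i → lookup q i ≡ true → lookup (p ─ q) i ≡ false
  lookup-─-inside (x ∷ p) (y ∷ q) zero refl = refl
  lookup-─-inside (x ∷ p) (y ∷ q) (suc i) qᵢ = lookup-─-inside p q i qᵢ

  lookup-─-outside : ∀ {n} (p q : Subset n) i → lookup q i ≡ false → lookup (p ─ q) i ≡ lookup p i
  lookup-─-outside (x ∷ p) (y ∷ q) zero refl = refl
  lookup-─-outside (x ∷ p) (y ∷ q) (suc i) qᵢ = lookup-─-outside p q i qᵢ

  ∈⇒lookup≡true : ∀ {n} {B : Subset n} {e} → e ∈ B → lookup B e ≡ true
  ∈⇒lookup≡true = []=⇒lookup

  ∉⇒lookup≡false : ∀ {n} {B : Subset n} {e} → e ∉ B → lookup B e ≡ false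
  ∉⇒lookup≡false {B = B} {e} e∉B with lookup B e in Bₑ
  ... | true = ⊥-elim (e∉B (lookup⇒[]= e B Bₑ))
  ... | false = refl

  lookup≡false⇒∉ : ∀ {n} {B : Subset n} {e} → lookup B e ≡ false → e ∉ B
  lookup≡false⇒∉ Bₑ e∈B with trans (sym Bₑ) ([]=⇒lookup e∈B)
  ... | ()

  swap : ∀ {n} → Subset n → Fin n → Fin n → Subset n
  swap B e f = (B ∖ e) ∪ ⁅ f ⁆

  lookup-swap-new : ∀ {n} (B : Subset n) e f → lookup (swap B e f) f ≡ true
  lookup-swap-new B e f = trans (lookup-zipWith _∨_ f (B ∖ e) ⁅ f ⁆)
    (trans (cong (lookup (B ∖ e) f ∨_) (lookup-⁅x⁆-x f)) (BoolP.∨-zeroʳ _))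

  lookup-swap-old : ∀ {n} (B : Subset n) {e f} → e ≢ f → lookup (swap B e f) e ≡ false
  lookup-swap-old B {e} {f} e≢f = trans (lookup-zipWith _∨_ e (B ∖ e) ⁅ f ⁆)
    (cong₂ _∨_ (lookup-─-inside B ⁅ e ⁆ e (lookup-⁅x⁆-x e)) (lookup-⁅x⁆-y e≢f))

  lookup-swap-other : ∀ {n} (B : Subset n) {e f i} → i ≢ e → i ≢ f → lookup (swap B e f) i ≡ lookup B i
  lookup-swap-other B {e} {f} {i} i≢e i≢f = trans (lookup-zipWith _∨_ i (B ∖ e) ⁅ f ⁆)
    (trans (cong₂ _∨_ (lookup-─-outside B ⁅ e ⁆ i (lookup-⁅x⁆-y i≢e)) (lookup-⁅x⁆-y i≢f))
           (BoolP.∨-identityʳ _))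

  distinct-by-lookup : ∀ {n} (B : Subset n) {e f} → lookup B e ≡ true → lookup B f ≡ false → e ≢ f
  distinct-by-lookup B Bₑ Bf refl with trans (sym Bₑ) Bf
  ... | ()

  sizeIn-swap : ∀ {n} (A : Fin n → Bool) (B : Subset n) e f → lookup B e ≡ true → lookup B f ≡ false →
    sizeIn A (swap B e f) + Bool→ℕ (A e) ≡ sizeIn A B + Bool→ℕ (A f)
  sizeIn-swap A B e f Bₑ Bf = begin
    sizeIn A (swap B e f) + Bool→ℕ (A e)      ≡⟨ cong (_+ Bool→ℕ (A e)) add-f ⟩
    sizeIn A (B ∖ e) + Bool→ℕ (A f) + Bool→ℕ (A e) ≡⟨ xy∙z≈xz∙y (sizeIn A (B ∖ e)) _ _ ⟩
    sizeIn A (B ∖ e) + Bool→ℕ (A e) + Bool→ℕ (A f) ≡⟨ cong (_+ Bool→ℕ (A f)) (sym remove-e) ⟩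
    sizeIn A B + Bool→ℕ (A f)                 ∎
    where
    open ≡-Reasoning
    e≢f = distinct-by-lookup B Bₑ Bf
    remove-e : sizeIn A B ≡ sizeIn A (B ∖ e) + Bool→ℕ (A e)
    remove-e = count-∧-update A (lookup B) (lookup (B ∖ e)) e Bₑ
      (lookup-─-inside B ⁅ e ⁆ e (lookup-⁅x⁆-x e))
      (λ i i≢e → sym (lookup-─-outside B ⁅ e ⁆ i (lookup-⁅x⁆-y i≢e)))
    add-f : sizeIn A (swap B e f) ≡ sizeIn A (B ∖ e) + Bool→ℕ (A f)
    add-f = count-∧-update A (lookup (swap B e f)) (lookup (B ∖ e)) f (lookup-swap-new B e f)
      (trans (lookup-─-outside B ⁅ e ⁆ f (lookup-⁅x⁆-y (λ f≡e → e≢f (sym f≡e)))) Bf)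
      (λ i i≢f → trans (lookup-zipWith _∨_ i (B ∖ e) ⁅ f ⁆)
                       (trans (cong (lookup (B ∖ e) i ∨_) (lookup-⁅x⁆-y i≢f)) (BoolP.∨-identityʳ _)))

  swap-Bool→ℕ : ∀ {n} (B₁ B₂ : Subset n) {e f} →
    lookup B₁ e ≡ true → lookup B₂ e ≡ false → lookup B₂ f ≡ true → lookup B₁ f ≡ false →
    ∀ i → Bool→ℕ (lookup (swap B₁ e f) i) + Bool→ℕ (lookup (swap B₂ f e) i)
        ≡ Bool→ℕ (lookup B₁ i) + Bool→ℕ (lookup B₂ i)
  swap-Bool→ℕ B₁ B₂ {e} {f} B₁ₑ B₂ₑ B₂f B₁f i = pointwise (i Fin.≟ e) (i Fin.≟ f)
    where
    e≢f = distinct-by-lookup B₁ B₁ₑ B₁f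
    f≢e = distinct-by-lookup B₂ B₂f B₂ₑ
    pointwise : Dec (i ≡ e) → Dec (i ≡ f) →
      Bool→ℕ (lookup (swap B₁ e f) i) + Bool→ℕ (lookup (swap B₂ f e) i) ≡ Bool→ℕ (lookup B₁ i) + Bool→ℕ (lookup B₂ i)
    pointwise (yes i≡e) _ rewrite i≡e | lookup-swap-old B₁ e≢f | lookup-swap-new B₂ f e | B₁ₑ | B₂ₑ = refl
    pointwise (no _) (yes i≡f) rewrite i≡f | lookup-swap-new B₁ e f | lookup-swap-old B₂ f≢e | B₂f | B₁f = refl
    pointwise (no i≢e) (no i≢f) rewrite lookup-swap-other B₁ i≢e i≢f | lookup-swap-other B₂ i≢f i≢e = refl

  decrementAt : Fin 3 → (Fin 3 → ℕ) → Fin 3 → ℕ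
  decrementAt X q Y = if ⌊ X Fin.≟ Y ⌋ then ℕ.pred (q Y) else q Y

  quotaSet : ∀ {n} → (Fin n → Fin 3) → (Fin 3 → ℕ) → Subset n
  quotaSet {zero} lab q = []
  quotaSet {suc n} lab q = (0 ℕ.<ᵇ q (lab zero)) ∷ quotaSet (λ i → lab (suc i)) (decrementAt (lab zero) q)

  sizeIn-quotaSet : ∀ {n} (lab : Fin n → Fin 3) (q : Fin 3 → ℕ) → (∀ Y → q Y ≤ blockSize lab Y) →
    ∀ Y → sizeIn (blockSet lab Y) (quotaSet lab q) ≡ q Y
  sizeIn-quotaSet {zero} lab q q≤size Y = sym (ℕP.n≤0⇒n≡0 (q≤size Y))
  sizeIn-quotaSet {suc n} lab q q≤size Y = first-and-rest (lab zero Fin.≟ Y)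
    where
    lab′ = λ i → lab (suc i)
    q′ = decrementAt (lab zero) q
    q′≤size : ∀ Y′ → q′ Y′ ≤ blockSize lab′ Y′
    q′≤size Y′ with lab zero Fin.≟ Y′ | q≤size Y′
    ... | yes _ | q≤1+size = ℕP.pred-mono-≤ q≤1+size
    ... | no _ | q≤size′ = q≤size′
    rest : count (λ i → blockSet lab Y (suc i) ∧ lookup (quotaSet lab′ q′) i) ≡ q′ Y
    rest = trans (count-cong (λ i → cong (_∧ lookup (quotaSet lab′ q′) i) (sym (blockSet-suc lab Y i))))
                 (sizeIn-quotaSet lab′ q′ q′≤size Y)
    take-or-skip : ∀ m → Bool→ℕ (0 ℕ.<ᵇ m) + ℕ.pred m ≡ m
    take-or-skip zero = refl
    take-or-skip (suc m) = refl
    q′-here : lab zero ≡ Y → q′ Y ≡ ℕ.pred (q Y)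
    q′-here lab₀≡Y with lab zero Fin.≟ Y
    ... | yes _ = refl
    ... | no lab₀≢Y = ⊥-elim (lab₀≢Y lab₀≡Y)
    q′-elsewhere : lab zero ≢ Y → q′ Y ≡ q Y
    q′-elsewhere lab₀≢Y with lab zero Fin.≟ Y
    ... | yes lab₀≡Y = ⊥-elim (lab₀≢Y lab₀≡Y)
    ... | no _ = refl
    first-and-rest : Dec (lab zero ≡ Y) → sizeIn (blockSet lab Y) (quotaSet lab q) ≡ q Y
    first-and-rest (yes lab₀≡Y) rewrite blockSet-≡ lab lab₀≡Y =
      trans (cong₂ _+_ (cong (λ X → Bool→ℕ (0 ℕ.<ᵇ q X)) lab₀≡Y) (trans rest (q′-here lab₀≡Y))) (take-or-skip (q Y))
    first-and-rest (no lab₀≢Y) rewrite blockSet-≢ lab lab₀≢Y = trans rest (q′-elsewhere lab₀≢Y)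

module Rounding (D-1 : ℕ) where
  open FiniteSums
  open SubsetCounting
  open import Data.Nat as ℕ using (ℕ; zero; suc; _+_; _*_; _∸_; _≤_; _<_; _%_; _<ᵇ_; s≤s)
  open import Data.Nat.Properties
  open import Data.Nat.DivMod using ([m+n]%n≡m%n; m<n⇒m%n≡m; m%n<n)
  open import Data.Bool using (Bool; true; if_then_else_; _∧_; T)
  open import Data.Fin as Fin using (Fin; zero; suc; toℕ)
  import Data.Fin.Properties as FinP
  open import Data.Fin.Subset using (Subset)
  open import Data.Vec using (lookup; tabulate)
  open import Data.Vec.Properties using (lookup∘tabulate)
  open import Algebra.Properties.Semiring.Sum +-*-semiring using (sum; sum-cong-≗; ∑-distrib-+; sum-replicate-zero)
  open import Relation.Nullary using (Dec; yes; no)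
  open import Relation.Binary.PropositionalEquality
    using (_≡_; refl; cong; cong₂; sym; trans; subst; module ≡-Reasoning)

  D : ℕ
  D = suc D-1

  instance
    D-nonZero : ℕ.NonZero D
    D-nonZero = _

  residueCount : Fin D → ℕ → ℕ → ℕ
  residueCount r L zero = 0
  residueCount r L (suc m) = Bool→ℕ (L % D ℕ.≡ᵇ toℕ r) + residueCount r (suc L) m

  residueCount-+ : ∀ r L m₁ m₂ → residueCount r L (m₁ + m₂) ≡ residueCount r L m₁ + residueCount r (L + m₁) m₂
  residueCount-+ r L zero m₂ rewrite +-identityʳ L = refl
  residueCount-+ r L (suc m₁) m₂ rewrite residueCount-+ r (suc L) m₁ m₂ | +-suc L m₁ =
    sym (+-assoc (Bool→ℕ (L % D ℕ.≡ᵇ toℕ r)) _ _)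

  residueCount-shift : ∀ r L m → residueCount r (L + D) m ≡ residueCount r L m
  residueCount-shift r L zero = refl
  residueCount-shift r L (suc m) rewrite [m+n]%n≡m%n L D {{D-nonZero}} =
    cong (_ +_) (residueCount-shift r (suc L) m)

  residueCount-suc : ∀ r L → residueCount r (suc L) D ≡ residueCount r L D
  residueCount-suc r L = +-cancelˡ-≡ (residueCount r L 1) _ _ (begin
    residueCount r L 1 + residueCount r (suc L) D   ≡⟨ cong (λ L′ → residueCount r L 1 + residueCount r L′ D) (+-comm 1 L) ⟩
    residueCount r L 1 + residueCount r (L + 1) D   ≡⟨ residueCount-+ r L 1 D ⟨
    residueCount r L (1 + D)                        ≡⟨ cong (residueCount r L) (+-comm 1 D) ⟩
    residueCount r L (D + 1)                        ≡⟨ residueCount-+ r L D 1 ⟩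
    residueCount r L D + residueCount r (L + D) 1   ≡⟨ cong (residueCount r L D +_) (residueCount-shift r L 1) ⟩
    residueCount r L D + residueCount r L 1         ≡⟨ +-comm (residueCount r L D) _ ⟩
    residueCount r L 1 + residueCount r L D         ∎)
    where open ≡-Reasoning

  residueCount-initial : ∀ r m → m ≤ D → residueCount r 0 m ≡ Bool→ℕ (toℕ r <ᵇ m)
  residueCount-initial r zero _ = refl
  residueCount-initial r (suc m) 1+m≤D = begin
    residueCount r 0 (suc m)                         ≡⟨ cong (residueCount r 0) (+-comm 1 m) ⟩
    residueCount r 0 (m + 1)                         ≡⟨ residueCount-+ r 0 m 1 ⟩
    residueCount r 0 m + residueCount r m 1          ≡⟨ cong₂ _+_ (residueCount-initial r m (<⇒≤ 1+m≤D)) last ⟩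
    Bool→ℕ (toℕ r <ᵇ m) + Bool→ℕ (m ℕ.≡ᵇ toℕ r)      ≡⟨ indicators (toℕ r) m ⟩
    Bool→ℕ (toℕ r <ᵇ suc m)                          ∎
    where
    open ≡-Reasoning
    last : residueCount r m 1 ≡ Bool→ℕ (m ℕ.≡ᵇ toℕ r)
    last rewrite m<n⇒m%n≡m 1+m≤D = +-identityʳ _
    indicators : ∀ t m → Bool→ℕ (t <ᵇ m) + Bool→ℕ (m ℕ.≡ᵇ t) ≡ Bool→ℕ (t <ᵇ suc m)
    indicators zero zero = refl
    indicators zero (suc m) = refl
    indicators (suc t) zero = refl
    indicators (suc t) (suc m) = indicators t m

  residueCount-period : ∀ r L → residueCount r L D ≡ 1
  residueCount-period r zero = trans (residueCount-initial r D ≤-refl) (T⇒Bool→ℕ≡1 (<⇒<ᵇ (FinP.toℕ<n r)))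
    where
    T⇒Bool→ℕ≡1 : ∀ {b} → T b → Bool→ℕ b ≡ 1
    T⇒Bool→ℕ≡1 {true} _ = refl
  residueCount-period r (suc L) = trans (residueCount-suc r L) (residueCount-period r L)

  residueCount-multiple : ∀ r L q → residueCount r L (q * D) ≡ q
  residueCount-multiple r L zero = refl
  residueCount-multiple r L (suc q) = trans (residueCount-+ r L D (q * D))
    (cong₂ _+_ (residueCount-period r L) (residueCount-multiple r (L + D) q))

  residueCount-mono : ∀ r L {m m′} → m ≤ m′ → residueCount r L m ≤ residueCount r L m′
  residueCount-mono r L {m} {m′} m≤m′ = subst (λ m″ → residueCount r L m ≤ residueCount r L m″) (m+[n∸m]≡n m≤m′)
    (subst (residueCount r L m ≤_) (sym (residueCount-+ r L m (m′ ∸ m))) (m≤m+n _ _))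

  residueCount-≤ : ∀ r L m a → m ≤ a * D → residueCount r L m ≤ a
  residueCount-≤ r L m a m≤aD = subst (residueCount r L m ≤_) (residueCount-multiple r L a) (residueCount-mono r L m≤aD)

  residueCount-≥ : ∀ r L m a → a * D ≤ m → a ≤ residueCount r L m
  residueCount-≥ r L m a aD≤m = subst (_≤ residueCount r L m) (residueCount-multiple r L a) (residueCount-mono r L aD≤m)

  residueCount-≤1 : ∀ r L m → m ≤ D → residueCount r L m ≤ 1
  residueCount-≤1 r L m m≤D = residueCount-≤ r L m 1 (subst (m ≤_) (sym (+-identityʳ D)) m≤D)

  sum-≡ᵇ : ∀ {N} t → t < N → sum (λ (r : Fin N) → Bool→ℕ (t ℕ.≡ᵇ toℕ r)) ≡ 1
  sum-≡ᵇ {suc N} zero _ = cong suc (sum-replicate-zero N)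
  sum-≡ᵇ {suc N} (suc t) 1+t<1+N = sum-≡ᵇ t (≤-pred 1+t<1+N)

  sum-residueCount : ∀ L m → sum (λ r → residueCount r L m) ≡ m
  sum-residueCount L zero = sum-replicate-zero D
  sum-residueCount L (suc m) = trans (∑-distrib-+ (λ r → Bool→ℕ (L % D ℕ.≡ᵇ toℕ r)) (λ r → residueCount r (suc L) m))
    (cong₂ _+_ (sum-≡ᵇ (L % D) (m%n<n L D)) (sum-residueCount (suc L) m))

  advance : ∀ {n} → (Fin 3 → ℕ) → (Fin (suc n) → Fin 3) → (Fin (suc n) → ℕ) → Fin 3 → ℕ
  advance o lab y Y = if blockSet lab Y zero then o Y + y zero else o Y

  -- Element i gets the window [position i, position i + y i); the windows of block Y are laid
  -- end to end from o Y. Layer r takes the elements whose window contains a number ≡ r (mod D),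
  -- which happens at most once as y i ≤ D.
  position : ∀ {n} → (Fin 3 → ℕ) → (Fin n → Fin 3) → (Fin n → ℕ) → Fin n → ℕ
  position o lab y zero = o (lab zero)
  position o lab y (suc i) = position (advance o lab y) (λ i → lab (suc i)) (λ i → y (suc i)) i

  inLayer : ∀ {n} → Fin D → (Fin 3 → ℕ) → (Fin n → Fin 3) → (Fin n → ℕ) → Fin n → Bool
  inLayer r o lab y i = 0 <ᵇ residueCount r (position o lab y i) (y i)

  blockSum : ∀ {n} → (Fin n → Fin 3) → (Fin n → ℕ) → Fin 3 → ℕ
  blockSum lab y Y = sum (restrict (blockSet lab Y) y)

  Bool→ℕ-0<ᵇ : ∀ v → v ≤ 1 → Bool→ℕ (0 <ᵇ v) ≡ v
  Bool→ℕ-0<ᵇ zero _ = refl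
  Bool→ℕ-0<ᵇ (suc zero) _ = refl
  Bool→ℕ-0<ᵇ (suc (suc v)) (s≤s ())

  sizeIn-inLayer : ∀ {n} r o (lab : Fin n → Fin 3) (y : Fin n → ℕ) Y → (∀ i → y i ≤ D) →
    count (λ i → blockSet lab Y i ∧ inLayer r o lab y i) ≡ residueCount r (o Y) (blockSum lab y Y)
  sizeIn-inLayer {zero} r o lab y Y y≤D = refl
  sizeIn-inLayer {suc n} r o lab y Y y≤D = first-and-rest (lab zero Fin.≟ Y)
    where
    open ≡-Reasoning
    lab′ = λ i → lab (suc i)
    y′ = λ i → y (suc i)
    o′ = advance o lab y
    first = Bool→ℕ (blockSet lab Y zero ∧ inLayer r o lab y zero)
    rest = count (λ i → blockSet lab Y (suc i) ∧ inLayer r o′ lab′ y′ i)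
    rest≡ : rest ≡ residueCount r (o′ Y) (blockSum lab′ y′ Y)
    rest≡ = trans (count-cong (λ i → cong (_∧ inLayer r o′ lab′ y′ i) (sym (blockSet-suc lab Y i))))
                  (sizeIn-inLayer r o′ lab′ y′ Y (λ i → y≤D (suc i)))
    blockSum≡ : ∀ {b} → blockSet lab Y zero ≡ b → blockSum lab y Y ≡ (if b then y zero else 0) + blockSum lab′ y′ Y
    blockSum≡ Y₀ = cong₂ _+_ (cong (λ b → if b then y zero else 0) Y₀)
                             (sum-cong-≗ (λ i → cong (λ b → if b then y (suc i) else 0) (sym (blockSet-suc lab Y i))))
    first-and-rest : Dec (lab zero ≡ Y) → first + rest ≡ residueCount r (o Y) (blockSum lab y Y)
    first-and-rest (yes lab₀≡Y) = begin
      first + rest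
        ≡⟨ cong₂ _+_ first≡ rest≡ ⟩
      residueCount r (o Y) (y zero) + residueCount r (o′ Y) (blockSum lab′ y′ Y)
        ≡⟨ cong (λ L → residueCount r (o Y) (y zero) + residueCount r L (blockSum lab′ y′ Y))
                (cong (λ b → if b then o Y + y zero else o Y) (blockSet-≡ lab lab₀≡Y)) ⟩
      residueCount r (o Y) (y zero) + residueCount r (o Y + y zero) (blockSum lab′ y′ Y)
        ≡⟨ residueCount-+ r (o Y) (y zero) _ ⟨
      residueCount r (o Y) (y zero + blockSum lab′ y′ Y)
        ≡⟨ cong (residueCount r (o Y)) (blockSum≡ (blockSet-≡ lab lab₀≡Y)) ⟨
      residueCount r (o Y) (blockSum lab y Y) ∎
      where
      first≡ : first ≡ residueCount r (o Y) (y zero)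
      first≡ rewrite blockSet-≡ lab lab₀≡Y | sym lab₀≡Y =
        Bool→ℕ-0<ᵇ _ (residueCount-≤1 r (o (lab zero)) (y zero) (y≤D zero))
    first-and-rest (no lab₀≢Y) = begin
      first + rest
        ≡⟨ cong (λ b → Bool→ℕ (b ∧ inLayer r o lab y zero) + rest) (blockSet-≢ lab lab₀≢Y) ⟩
      rest
        ≡⟨ rest≡ ⟩
      residueCount r (o′ Y) (blockSum lab′ y′ Y)
        ≡⟨ cong (λ L → residueCount r L (blockSum lab′ y′ Y))
                (cong (λ b → if b then o Y + y zero else o Y) (blockSet-≢ lab lab₀≢Y)) ⟩
      residueCount r (o Y) (blockSum lab′ y′ Y)
        ≡⟨ cong (residueCount r (o Y)) (blockSum≡ (blockSet-≢ lab lab₀≢Y)) ⟨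
      residueCount r (o Y) (blockSum lab y Y) ∎

  sum-inLayer : ∀ {n} o (lab : Fin n → Fin 3) (y : Fin n → ℕ) → (∀ i → y i ≤ D) →
    ∀ i → sum (λ r → Bool→ℕ (inLayer r o lab y i)) ≡ y i
  sum-inLayer o lab y y≤D i =
    trans (sum-cong-≗ (λ r → Bool→ℕ-0<ᵇ _ (residueCount-≤1 r (position o lab y i) (y i) (y≤D i))))
          (sum-residueCount (position o lab y i) (y i))

  module Layers {n} (lab : Fin n → Fin 3) (y : Fin n → ℕ) (y≤D : ∀ i → y i ≤ D) where

    offset : Fin 3 → ℕ
    offset zero = 0
    offset (suc zero) = blockSum lab y j₁
    offset (suc (suc zero)) = blockSum lab y j₁ + blockSum lab y j₂

    layer : Fin D → Subset n
    layer r = tabulate (inLayer r offset lab y)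

    sum-layer : ∀ i → sum (λ r → Bool→ℕ (lookup (layer r) i)) ≡ y i
    sum-layer i = trans (sum-cong-≗ (λ r → cong Bool→ℕ (lookup∘tabulate (inLayer r offset lab y) i)))
                        (sum-inLayer offset lab y y≤D i)

    sizeIn-layer : ∀ r Y → sizeIn (blockSet lab Y) (layer r) ≡ residueCount r (offset Y) (blockSum lab y Y)
    sizeIn-layer r Y = trans (count-cong (λ i → cong (blockSet lab Y i ∧_) (lookup∘tabulate (inLayer r offset lab y) i)))
                             (sizeIn-inLayer r offset lab y Y y≤D)

    size-layer : ∀ r → size (layer r) ≡ residueCount r 0 (sum y)
    size-layer r = begin
      count (lookup (layer r))
        ≡⟨ count-partition lab (lookup (layer r)) ⟩
      Σ₃ (λ Y → sizeIn (blockSet lab Y) (layer r))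
        ≡⟨ cong₂ _+_ (cong₂ _+_ (sizeIn-layer r j₁) (sizeIn-layer r j₂)) (sizeIn-layer r j₃) ⟩
      residueCount r 0 s₁ + residueCount r s₁ s₂ + residueCount r (s₁ + s₂) s₃
        ≡⟨ cong (_+ residueCount r (s₁ + s₂) s₃) (residueCount-+ r 0 s₁ s₂) ⟨
      residueCount r 0 (s₁ + s₂) + residueCount r (s₁ + s₂) s₃
        ≡⟨ residueCount-+ r 0 (s₁ + s₂) s₃ ⟨
      residueCount r 0 (Σ₃ (blockSum lab y))
        ≡⟨ cong (residueCount r 0) (sum-partition lab y) ⟨
      residueCount r 0 (sum y) ∎
      where
      open ≡-Reasoning
      s₁ = blockSum lab y j₁
      s₂ = blockSum lab y j₂
      s₃ = blockSum lab y j₃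

module ConvexHulls where

  open ℕ→ℚ-Properties
  open FiniteSums
  open SubsetCounting
  open import Data.Nat as ℕ using (ℕ; zero; suc)
  open import Data.Bool using (Bool; true; false; if_then_else_)
  open import Data.Rational as ℚ using (ℚ; 0ℚ; 1ℚ; _+_; _*_; _-_; _≤_; _<_)
  import Data.Rational.Properties as ℚP
  open import Data.Rational.Solver using (module +-*-Solver)
  open import Data.Fin using (Fin; zero; suc)
  open import Data.Fin.Subset using (Subset)
  open import Data.Vec using (lookup)
  open import Data.List using (List; []; _∷_; tabulate)
  import Data.Nat.Properties as ℕP
  open import Algebra.Properties.Semiring.Sum ℕP.+-*-semiring using (sum)
  open import Data.Product using (Σ; _×_; _,_; proj₁; proj₂)
  open import Data.Empty using (⊥-elim)
  open import Relation.Binary.Definitions using (tri<; tri≈; tri>)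
  open import Relation.Binary.PropositionalEquality
    using (_≡_; refl; cong; cong₂; sym; trans; subst; module ≡-Reasoning)
  open +-*-Solver using (solve; _:+_; _:*_; _:-_; _:=_)

  InHull : ∀ {n} → (Subset n → Set) → Point n → Set
  InHull {n} F x = Σ (List (ℚ × Subset n)) λ l →
    AllTerms (λ c B → (0ℚ ≤ c) × F B) l × (coeffSum l ≡ 1ℚ) × ((i : Fin n) → combo l i ≡ x i)

  InPositiveHull : ∀ {n} → (Subset n → Set) → Point n → Set
  InPositiveHull {n} F x = Σ (List (ℚ × Subset n)) λ l →
    AllTerms (λ c B → (0ℚ < c) × F B) l × (coeffSum l ≡ 1ℚ) × ((i : Fin n) → combo l i ≡ x i)

  AllTerms-map : ∀ {n} {P Q : ℚ → Subset n → Set} {l} → (∀ {c B} → P c B → Q c B) → AllTerms P l → AllTerms Q l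
  AllTerms-map f [] = []
  AllTerms-map f (p ∷ ps) = f p ∷ AllTerms-map f ps

  AllTerms-zip : ∀ {n} {P Q : ℚ → Subset n → Set} {l} → AllTerms P l → AllTerms Q l → AllTerms (λ c B → P c B × Q c B) l
  AllTerms-zip [] [] = []
  AllTerms-zip (p ∷ ps) (q ∷ qs) = (p , q) ∷ AllTerms-zip ps qs

  positiveHull⇒hull : ∀ {n} {F : Subset n → Set} {x} → InPositiveHull F x → InHull F x
  positiveHull⇒hull (l , terms , Σc≡1 , l≡x) = l , AllTerms-map (λ (c>0 , FB) → ℚP.<⇒≤ c>0 , FB) terms , Σc≡1 , l≡x

  weightedSum : ∀ {n} → (Subset n → ℚ) → List (ℚ × Subset n) → ℚ
  weightedSum g [] = 0ℚ
  weightedSum g ((c , B) ∷ l) = c * g B + weightedSum g l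

  combo-at : ∀ {n} (l : List (ℚ × Subset n)) i → combo l i ≡ weightedSum (λ B → χ B i) l
  combo-at [] i = refl
  combo-at ((c , B) ∷ l) i = cong (c * χ B i +_) (combo-at l i)

  dot-combo : ∀ {n} (w : Point n) (l : List (ℚ × Subset n)) → dot w (combo l) ≡ weightedSum (λ B → dot w (χ B)) l
  dot-combo {n} w [] = trans (sumFin-cong (λ i → ℚP.*-zeroʳ (w i))) (sumFin-zero n)
  dot-combo {n} w ((c , B) ∷ l) = begin
    sumFin (λ i → w i * (c * χ B i + combo l i))
      ≡⟨ sumFin-cong (λ i → solve 4 (λ w c x y → w :* (c :* x :+ y) := c :* (w :* x) :+ w :* y)
                                  refl (w i) c (χ B i) (combo l i)) ⟩
    sumFin (λ i → c * (w i * χ B i) + w i * combo l i)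
      ≡⟨ sumFin-+ (λ i → c * (w i * χ B i)) (λ i → w i * combo l i) ⟩
    sumFin (λ i → c * (w i * χ B i)) + dot w (combo l)
      ≡⟨ cong₂ _+_ (sumFin-*ˡ c (λ i → w i * χ B i)) (dot-combo w l) ⟩
    c * dot w (χ B) + weightedSum (λ B → dot w (χ B)) l ∎
    where open ≡-Reasoning

  dot-cong : ∀ {n} (w : Point n) {x y : Point n} → (∀ i → x i ≡ y i) → dot w x ≡ dot w y
  dot-cong w x≗y = sumFin-cong (λ i → cong (w i *_) (x≗y i))

  indicator : ∀ {n} → (Fin n → Bool) → Point n
  indicator A i = if A i then 1ℚ else 0ℚ

  sumOver≡dot : ∀ {n} (A : Fin n → Bool) x → sumOver A x ≡ dot (indicator A) x
  sumOver≡dot A x = sumFin-cong pointwise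
    where
    pointwise : ∀ i → (if A i then x i else 0ℚ) ≡ indicator A i * x i
    pointwise i with A i
    ... | true = sym (ℚP.*-identityˡ (x i))
    ... | false = sym (ℚP.*-zeroˡ (x i))

  weightedSum-const : ∀ {n} (t : ℚ) (l : List (ℚ × Subset n)) → weightedSum (λ _ → t) l ≡ coeffSum l * t
  weightedSum-const t [] = sym (ℚP.*-zeroˡ t)
  weightedSum-const t ((c , B) ∷ l) rewrite weightedSum-const t l = sym (ℚP.*-distribʳ-+ t c (coeffSum l))

  weightedSum-mono-≤ : ∀ {n} {g h : Subset n → ℚ} {l} →
    AllTerms (λ c B → (0ℚ ≤ c) × (g B ≤ h B)) l → weightedSum g l ≤ weightedSum h l
  weightedSum-mono-≤ [] = ℚP.≤-refl
  weightedSum-mono-≤ (_∷_ {c} (0≤c , gB≤hB) terms) =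
    ℚP.+-mono-≤ (ℚP.*-monoˡ-≤-nonNeg c {{ℚ.nonNegative 0≤c}} gB≤hB) (weightedSum-mono-≤ terms)

  convex-≤ : ∀ {n} {g : Subset n → ℚ} {t} (l : List (ℚ × Subset n)) →
    AllTerms (λ c B → (0ℚ ≤ c) × (g B ≤ t)) l → coeffSum l ≡ 1ℚ → weightedSum g l ≤ t
  convex-≤ {t = t} l terms Σc≡1 = ℚP.≤-trans (weightedSum-mono-≤ terms)
    (ℚP.≤-reflexive (trans (weightedSum-const t l) (trans (cong (_* t) Σc≡1) (ℚP.*-identityˡ t))))

  convex-≥ : ∀ {n} {g : Subset n → ℚ} {t} (l : List (ℚ × Subset n)) →
    AllTerms (λ c B → (0ℚ ≤ c) × (t ≤ g B)) l → coeffSum l ≡ 1ℚ → t ≤ weightedSum g l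
  convex-≥ {t = t} l terms Σc≡1 = ℚP.≤-trans
    (ℚP.≤-reflexive (sym (trans (weightedSum-const t l) (trans (cong (_* t) Σc≡1) (ℚP.*-identityˡ t)))))
    (weightedSum-mono-≤ terms)

  +-tight : ∀ {a b a′ b′} → a ≤ b → a′ ≤ b′ → a + a′ ≡ b + b′ → (a ≡ b) × (a′ ≡ b′)
  +-tight {a} {b} {a′} {b′} a≤b a′≤b′ sums with ℚP.<-cmp a b
  ... | tri< a<b _ _ = ⊥-elim (ℚP.<-irrefl sums (ℚP.+-mono-<-≤ a<b a′≤b′))
  ... | tri> _ _ a>b = ⊥-elim (ℚP.<-irrefl refl (ℚP.<-≤-trans a>b a≤b))
  ... | tri≈ _ a≡b _ = a≡b , (begin
    a′              ≡⟨ solve 2 (λ a a′ → a′ := (a :+ a′) :- a) refl a a′ ⟩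
    (a + a′) - a    ≡⟨ cong₂ _-_ sums a≡b ⟩
    (b + b′) - b    ≡⟨ solve 2 (λ b b′ → (b :+ b′) :- b := b′) refl b b′ ⟩
    b′              ∎)
    where open ≡-Reasoning

  weightedSum-tight : ∀ {n} {g : Subset n → ℚ} {t} (l : List (ℚ × Subset n)) →
    AllTerms (λ c B → (0ℚ < c) × (g B ≤ t)) l → weightedSum g l ≡ coeffSum l * t →
    AllTerms (λ c B → g B ≡ t) l
  weightedSum-tight [] [] _ = []
  weightedSum-tight {g = g} {t} ((c , B) ∷ l) ((0<c , gB≤t) ∷ terms) sums =
    gB≡t ∷ weightedSum-tight l terms (proj₂ split)
    where
    instance
      c-positive : ℚ.Positive c
      c-positive = ℚ.positive 0<c
    rest≤ : weightedSum g l ≤ coeffSum l * t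
    rest≤ = ℚP.≤-trans (weightedSum-mono-≤ (AllTerms-map (λ (0<c′ , gB′≤t) → ℚP.<⇒≤ 0<c′ , gB′≤t) terms))
                       (ℚP.≤-reflexive (weightedSum-const t l))
    split = +-tight (ℚP.*-monoˡ-≤-nonNeg c {{ℚ.nonNegative (ℚP.<⇒≤ 0<c)}} gB≤t) rest≤
                    (trans sums (ℚP.*-distribʳ-+ t c (coeffSum l)))
    gB≡t : g B ≡ t
    gB≡t = ℚP.≤-antisym gB≤t (ℚP.*-cancelˡ-≤-pos c (ℚP.≤-reflexive (sym (proj₁ split))))

  hull-dot-≤ : ∀ {n} {F : Subset n → Set} {x} (w : Point n) t →
    (∀ {B} → F B → dot w (χ B) ≤ t) → InHull F x → dot w x ≤ t
  hull-dot-≤ w t bound (l , terms , Σc≡1 , l≡x) =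
    subst (_≤ t) (trans (sym (dot-combo w l)) (dot-cong w l≡x))
          (convex-≤ l (AllTerms-map (λ (0≤c , FB) → 0≤c , bound FB) terms) Σc≡1)

  hull-dot-≥ : ∀ {n} {F : Subset n → Set} {x} (w : Point n) t →
    (∀ {B} → F B → t ≤ dot w (χ B)) → InHull F x → t ≤ dot w x
  hull-dot-≥ w t bound (l , terms , Σc≡1 , l≡x) =
    subst (t ≤_) (trans (sym (dot-combo w l)) (dot-cong w l≡x))
          (convex-≥ l (AllTerms-map (λ (0≤c , FB) → 0≤c , bound FB) terms) Σc≡1)

  χ-unit-interval : ∀ {n} (B : Subset n) i → (0ℚ ≤ χ B i) × (χ B i ≤ 1ℚ)
  χ-unit-interval B i with lookup B i
  ... | true = ℚP.nonNegative⁻¹ 1ℚ , ℚP.≤-refl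
  ... | false = ℚP.≤-refl , ℚP.nonNegative⁻¹ 1ℚ

  hull-unit-interval : ∀ {n} {F : Subset n → Set} {x} → InHull F x → ∀ i → (0ℚ ≤ x i) × (x i ≤ 1ℚ)
  hull-unit-interval (l , terms , Σc≡1 , l≡x) i =
    subst (0ℚ ≤_) xᵢ (convex-≥ l (AllTerms-map (λ {_} {B} (0≤c , _) → 0≤c , proj₁ (χ-unit-interval B i)) terms) Σc≡1) ,
    subst (_≤ 1ℚ) xᵢ (convex-≤ l (AllTerms-map (λ {_} {B} (0≤c , _) → 0≤c , proj₂ (χ-unit-interval B i)) terms) Σc≡1)
    where xᵢ = trans (sym (combo-at l i)) (l≡x i)

  χ-inHull : ∀ {n} {F : Subset n → Set} {B} → F B → InHull F (χ B)
  χ-inHull {B = B} FB = (1ℚ , B) ∷ [] , (ℚP.nonNegative⁻¹ 1ℚ , FB) ∷ [] , ℚP.+-identityʳ 1ℚ ,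
    λ i → trans (ℚP.+-identityʳ _) (ℚP.*-identityˡ (χ B i))

  InHull-map : ∀ {n} {F G : Subset n → Set} {x} → (∀ {B} → F B → G B) → InHull F x → InHull G x
  InHull-map F⇒G (l , terms , Σc≡1 , l≡x) = l , AllTerms-map (λ (0≤c , FB) → 0≤c , F⇒G FB) terms , Σc≡1 , l≡x

  uniform : ∀ {m n} → ℚ → (Fin m → Subset n) → List (ℚ × Subset n)
  uniform c B = tabulate (λ r → c , B r)

  AllTerms-uniform : ∀ {m n} {P : ℚ → Subset n → Set} c (B : Fin m → Subset n) → (∀ r → P c (B r)) → AllTerms P (uniform c B)
  AllTerms-uniform {zero} c B PB = []
  AllTerms-uniform {suc m} c B PB = PB zero ∷ AllTerms-uniform c (λ r → B (suc r)) (λ r → PB (suc r))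

  coeffSum-uniform : ∀ {m n} c (B : Fin m → Subset n) → coeffSum (uniform c B) ≡ c * ℕ→ℚ m
  coeffSum-uniform {zero} c B = sym (ℚP.*-zeroʳ c)
  coeffSum-uniform {suc m} c B = begin
    c + coeffSum (uniform c (λ r → B (suc r))) ≡⟨ cong (c +_) (coeffSum-uniform c (λ r → B (suc r))) ⟩
    c + c * ℕ→ℚ m                           ≡⟨ cong (_+ c * ℕ→ℚ m) (ℚP.*-identityʳ c) ⟨
    c * 1ℚ + c * ℕ→ℚ m                      ≡⟨ ℚP.*-distribˡ-+ c 1ℚ (ℕ→ℚ m) ⟨
    c * (1ℚ + ℕ→ℚ m)                        ≡⟨ cong (c *_) (ℕ→ℚ-homo-+ 1 m) ⟨
    c * ℕ→ℚ (suc m)                         ∎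
    where open ≡-Reasoning

  combo-uniform : ∀ {m n} c (B : Fin m → Subset n) i → combo (uniform c B) i ≡ c * ℕ→ℚ (sum (λ r → Bool→ℕ (lookup (B r) i)))
  combo-uniform {zero} c B i = sym (ℚP.*-zeroʳ c)
  combo-uniform {suc m} c B i = begin
    c * χ (B zero) i + combo (uniform c (λ r → B (suc r))) i
      ≡⟨ cong₂ (λ u v → c * u + v) (χ≡ℕ→ℚ∘Bool→ℕ (B zero) i) (combo-uniform c (λ r → B (suc r)) i) ⟩
    c * ℕ→ℚ b₀ + c * ℕ→ℚ rest ≡⟨ ℚP.*-distribˡ-+ c (ℕ→ℚ b₀) (ℕ→ℚ rest) ⟨
    c * (ℕ→ℚ b₀ + ℕ→ℚ rest)   ≡⟨ cong (c *_) (ℕ→ℚ-homo-+ b₀ rest) ⟨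
    c * ℕ→ℚ (b₀ ℕ.+ rest)     ∎
    where
    open ≡-Reasoning
    b₀ = Bool→ℕ (lookup (B zero) i)
    rest = sum (λ r → Bool→ℕ (lookup (B (suc r)) i))

  dot-indicator-χ : ∀ {n} (A : Fin n → Bool) (B : Subset n) → dot (indicator A) (χ B) ≡ ℕ→ℚ (sizeIn A B)
  dot-indicator-χ A B = trans (sym (sumOver≡dot A (χ B))) (sumOver-χ A B)

  hull-sumOver-≤ : ∀ {n} {F : Subset n → Set} {x} (A : Fin n → Bool) m →
    (∀ {B} → F B → sizeIn A B ℕ.≤ m) → InHull F x → sumOver A x ≤ ℕ→ℚ m
  hull-sumOver-≤ {x = x} A m bound hull = subst (_≤ ℕ→ℚ m) (sym (sumOver≡dot A x))
    (hull-dot-≤ (indicator A) (ℕ→ℚ m) (λ {B} FB → subst (_≤ ℕ→ℚ m) (sym (dot-indicator-χ A B)) (ℕ→ℚ-mono-≤ (bound FB))) hull)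

  hull-sumOver-≥ : ∀ {n} {F : Subset n → Set} {x} (A : Fin n → Bool) m →
    (∀ {B} → F B → m ℕ.≤ sizeIn A B) → InHull F x → ℕ→ℚ m ≤ sumOver A x
  hull-sumOver-≥ {x = x} A m bound hull = subst (ℕ→ℚ m ≤_) (sym (sumOver≡dot A x))
    (hull-dot-≥ (indicator A) (ℕ→ℚ m) (λ {B} FB → subst (ℕ→ℚ m ≤_) (sym (dot-indicator-χ A B)) (ℕ→ℚ-mono-≤ (bound FB))) hull)

module MatroidFaces where

  open ℕ→ℚ-Properties
  open FiniteSums
  open SubsetCounting
  open ConvexHulls
  open import Data.Nat as ℕ using (ℕ; zero; suc)
  open import Data.Bool using (true; false)
  open import Data.Rational as ℚ using (ℚ; 0ℚ; 1ℚ; _+_; _*_; _≤_)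
  import Data.Rational.Properties as ℚP
  open import Data.Fin using (Fin)
  open import Data.Fin.Subset using (Subset; _∈_; _∉_)
  open import Data.Fin.Subset.Properties using (anySubset?)
  open import Data.Vec using ([]; _∷_; lookup)
  open import Data.Vec.Properties using (lookup⇒[]=)
  open import Data.Product using (Σ; ∃; _×_; _,_; proj₁; proj₂)
  open import Data.Empty using (⊥-elim)
  open import Function using (_∘_; _⇔_; Equivalence)
  open import Relation.Nullary using (yes; no)
  open import Relation.Unary using (Decidable)
  open import Relation.Binary.PropositionalEquality
    using (_≡_; cong; cong₂; sym; trans; module ≡-Reasoning)

  argmax : ∀ {n} {P : Subset n → Set} → Decidable P → (v : Subset n → ℚ) → ∃ P →
    Σ (Subset n) λ M → P M × (∀ B → P B → v B ≤ v M)
  argmax {zero} P? v ([] , P[]) = [] , P[] , λ { [] _ → ℚP.≤-refl }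
  argmax {suc n} {P} P? v (B , PB)
    with anySubset? (P? ∘ (true ∷_)) | anySubset? (P? ∘ (false ∷_))
  ... | yes ∃in | yes ∃out with argmax (P? ∘ (true ∷_)) (v ∘ (true ∷_)) ∃in
                              | argmax (P? ∘ (false ∷_)) (v ∘ (false ∷_)) ∃out
  ...   | M₁ , PM₁ , max₁ | M₂ , PM₂ , max₂ with v (true ∷ M₁) ℚP.≤? v (false ∷ M₂)
  ...     | yes v₁≤v₂ = false ∷ M₂ , PM₂ , λ { (true ∷ B′) PB′ → ℚP.≤-trans (max₁ B′ PB′) v₁≤v₂
                                             ; (false ∷ B′) PB′ → max₂ B′ PB′ }
  ...     | no v₁≰v₂ = true ∷ M₁ , PM₁ , λ { (true ∷ B′) PB′ → max₁ B′ PB′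
                                            ; (false ∷ B′) PB′ → ℚP.≤-trans (max₂ B′ PB′) (ℚP.<⇒≤ (ℚP.≰⇒> v₁≰v₂)) }
  argmax {suc n} {P} P? v (B , PB) | yes ∃in | no ∄out with argmax (P? ∘ (true ∷_)) (v ∘ (true ∷_)) ∃in
  ... | M₁ , PM₁ , max₁ = true ∷ M₁ , PM₁ , λ { (true ∷ B′) PB′ → max₁ B′ PB′
                                             ; (false ∷ B′) PB′ → ⊥-elim (∄out (B′ , PB′)) }
  argmax {suc n} {P} P? v (B , PB) | no ∄in | yes ∃out with argmax (P? ∘ (false ∷_)) (v ∘ (false ∷_)) ∃out
  ... | M₂ , PM₂ , max₂ = false ∷ M₂ , PM₂ , λ { (true ∷ B′) PB′ → ⊥-elim (∄in (B′ , PB′))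
                                              ; (false ∷ B′) PB′ → max₂ B′ PB′ }
  argmax {suc n} {P} P? v (true ∷ B , PB) | no ∄in | no _ = ⊥-elim (∄in (B , PB))
  argmax {suc n} {P} P? v (false ∷ B , PB) | no _ | no ∄out = ⊥-elim (∄out (B , PB))

  SymmetricExchange : ∀ {n} → (Subset n → Set) → Set
  SymmetricExchange {n} F = ∀ B₁ B₂ → F B₁ → F B₂ → ∀ e → lookup B₁ e ≡ true → lookup B₂ e ≡ false →
    Σ (Fin n) λ f → (lookup B₂ f ≡ true) × (lookup B₁ f ≡ false) × F (swap B₁ e f) × F (swap B₂ f e)

  dot-χ-swap : ∀ {n} (w : Point n) (B₁ B₂ : Subset n) {e f} →
    lookup B₁ e ≡ true → lookup B₂ e ≡ false → lookup B₂ f ≡ true → lookup B₁ f ≡ false →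
    dot w (χ (swap B₁ e f)) + dot w (χ (swap B₂ f e)) ≡ dot w (χ B₁) + dot w (χ B₂)
  dot-χ-swap w B₁ B₂ {e} {f} B₁ₑ B₂ₑ B₂f B₁f = begin
    dot w (χ B₁′) + dot w (χ B₂′)               ≡⟨ sumFin-+ (λ i → w i * χ B₁′ i) (λ i → w i * χ B₂′ i) ⟨
    sumFin (λ i → w i * χ B₁′ i + w i * χ B₂′ i) ≡⟨ sumFin-cong pointwise ⟩
    sumFin (λ i → w i * χ B₁ i + w i * χ B₂ i)   ≡⟨ sumFin-+ (λ i → w i * χ B₁ i) (λ i → w i * χ B₂ i) ⟩
    dot w (χ B₁) + dot w (χ B₂)                 ∎
    where
    open ≡-Reasoning
    B₁′ = swap B₁ e f
    B₂′ = swap B₂ f e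
    χ-+ : ∀ X Y i → χ X i + χ Y i ≡ ℕ→ℚ (Bool→ℕ (lookup X i) ℕ.+ Bool→ℕ (lookup Y i))
    χ-+ X Y i = trans (cong₂ _+_ (χ≡ℕ→ℚ∘Bool→ℕ X i) (χ≡ℕ→ℚ∘Bool→ℕ Y i))
                      (sym (ℕ→ℚ-homo-+ (Bool→ℕ (lookup X i)) (Bool→ℕ (lookup Y i))))
    pointwise : ∀ i → w i * χ B₁′ i + w i * χ B₂′ i ≡ w i * χ B₁ i + w i * χ B₂ i
    pointwise i = begin
      w i * χ B₁′ i + w i * χ B₂′ i ≡⟨ ℚP.*-distribˡ-+ (w i) _ _ ⟨
      w i * (χ B₁′ i + χ B₂′ i)     ≡⟨ cong (w i *_) (trans (χ-+ B₁′ B₂′ i)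
                                        (trans (cong ℕ→ℚ (swap-Bool→ℕ B₁ B₂ B₁ₑ B₂ₑ B₂f B₁f i)) (sym (χ-+ B₁ B₂ i)))) ⟩
      w i * (χ B₁ i + χ B₂ i)       ≡⟨ ℚP.*-distribˡ-+ (w i) _ _ ⟩
      w i * χ B₁ i + w i * χ B₂ i   ∎

  face-resp-⇔ : ∀ {n} {P Q : Point n → Set} (c : Point n) → (∀ x → P x ⇔ Q x) →
    IsMatroidPolytope (face Q c) → IsMatroidPolytope (face P c)
  face-resp-⇔ c P⇔Q (M , faceQ⇔M) = M , λ x →
    (λ (Px , max) → proj₁ (faceQ⇔M x) (to (P⇔Q x) Px , λ y Qy → max y (from (P⇔Q y) Qy))) ,
    (λ inM → let (Qx , max) = proj₂ (faceQ⇔M x) inM in from (P⇔Q x) Qx , λ y Py → max y (to (P⇔Q y) Py))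
    where open Equivalence

  module FaceMatroid {n} {F : Subset n → Set} (F? : Decidable F) (nonempty : ∃ F) (exchange : SymmetricExchange F)
                     (P : Point n → Set) (P⇒hull : ∀ {x} → P x → InPositiveHull F x) (hull⇒P : ∀ {x} → InHull F x → P x)
                     (c : Point n) where

    value : Subset n → ℚ
    value B = dot c (χ B)

    Optimal : Subset n → Set
    Optimal B = F B × (∀ B′ → F B′ → value B′ ≤ value B)

    optimal-exists : ∃ Optimal
    optimal-exists = let (M , FM , max) = argmax F? value nonempty in M , FM , max

    optimal-exchange : ∀ B₁ B₂ → Optimal B₁ → Optimal B₂ → ∀ e → e ∈ B₁ → e ∉ B₂ →
      ∃ λ f → f ∈ B₂ × f ∉ B₁ × Optimal (swap B₁ e f)
    -- Both exchanged sets are feasible, hence of value at most optimal; their values add up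
    -- to value B₁ + value B₂, so both are optimal.
    optimal-exchange B₁ B₂ (FB₁ , max₁) (FB₂ , max₂) e e∈B₁ e∉B₂
      with exchange B₁ B₂ FB₁ FB₂ e (∈⇒lookup≡true e∈B₁) (∉⇒lookup≡false e∉B₂)
    ... | f , B₂f , B₁f , FB₁′ , FB₂′ =
      f , lookup⇒[]= f B₂ B₂f , lookup≡false⇒∉ B₁f ,
      FB₁′ , λ B′ FB′ → ℚP.≤-trans (max₁ B′ FB′) (ℚP.≤-reflexive (sym (proj₁ same-values)))
      where
      same-values = +-tight (max₁ _ FB₁′) (max₂ _ FB₂′)
        (dot-χ-swap c B₁ B₂ (∈⇒lookup≡true e∈B₁) (∉⇒lookup≡false e∉B₂) B₂f B₁f)

    faceMatroid : Matroid n
    faceMatroid = record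
      { IsBasis = Optimal
      ; nonempty = optimal-exists
      ; exchange = optimal-exchange
      }

    F⇒P : ∀ {B} → F B → P (χ B)
    F⇒P FB = hull⇒P (χ-inHull FB)

    face⇒hull : ∀ {x} → face P c x → InHull Optimal x
    face⇒hull {x} (Px , max) with P⇒hull Px
    ... | l , terms , Σc≡1 , l≡x =
      l , AllTerms-map optimalTerm (AllTerms-zip terms (weightedSum-tight l bounded average)) , Σc≡1 , l≡x
      where
      bounded : AllTerms (λ c′ B → (0ℚ ℚ.< c′) × (value B ≤ dot c x)) l
      bounded = AllTerms-map (λ {_} {B} (0<c , FB) → 0<c , max (χ B) (F⇒P FB)) terms
      average : weightedSum value l ≡ coeffSum l * dot c x
      average = begin
        weightedSum value l   ≡⟨ dot-combo c l ⟨
        dot c (combo l)       ≡⟨ dot-cong c l≡x ⟩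
        dot c x               ≡⟨ ℚP.*-identityˡ (dot c x) ⟨
        1ℚ * dot c x          ≡⟨ cong (_* dot c x) Σc≡1 ⟨
        coeffSum l * dot c x  ∎
        where open ≡-Reasoning
      optimalTerm : ∀ {c′ B} → ((0ℚ ℚ.< c′) × F B) × (value B ≡ dot c x) → (0ℚ ≤ c′) × Optimal B
      optimalTerm ((0<c , FB) , valueB≡) =
        ℚP.<⇒≤ 0<c , FB , λ B′ FB′ → ℚP.≤-trans (max (χ B′) (F⇒P FB′)) (ℚP.≤-reflexive (sym valueB≡))

    hull⇒face : ∀ {x} → InHull Optimal x → face P c x
    hull⇒face {x} hull = hull⇒P (InHull-map proj₁ hull) , λ y Py → ℚP.≤-trans (upper Py) lower
      where
      M = proj₁ optimal-exists
      FM = proj₁ (proj₂ optimal-exists)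
      maxM = proj₂ (proj₂ optimal-exists)
      upper : ∀ {y} → P y → dot c y ≤ value M
      upper Py = hull-dot-≤ c (value M) (maxM _) (positiveHull⇒hull (P⇒hull Py))
      lower : value M ≤ dot c x
      lower = hull-dot-≥ c (value M) (λ (_ , maxB) → maxB M FM) hull

    faces-are-matroid-polytopes : IsMatroidPolytope (face P c)
    faces-are-matroid-polytopes = faceMatroid , λ x → face⇒hull , hull⇒face

module BoxBases {n} (k : ℕ) (lab : Fin n → Fin 3) (ℓ h : Fin 3 → ℕ) where

  open FiniteSums using (Bool→ℕ)
  open FiniteSums
  open SubsetCounting
  open MatroidFaces using (SymmetricExchange)
  open import Data.Nat as ℕ using (zero; suc; _+_; _≤_; _<_)
  open import Data.Nat.Properties
  open import Data.Bool using (true; false; _∧_; not)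
  open import Algebra.Properties.CommutativeSemigroup +-commutativeSemigroup using (xy∙z≈xz∙y)
  import Data.Bool.Properties as BoolP
  open import Data.Fin as Fin using (zero; suc)
  open import Data.Fin.Properties using (any?; all?)
  open import Data.Fin.Subset using (Subset)
  open import Data.Vec using (lookup)
  open import Data.Product using (Σ; ∃; _×_; _,_; proj₁; proj₂)
  open import Data.Empty using (⊥-elim)
  open import Relation.Nullary using (Dec; yes; no; _×-dec_)
  open import Relation.Unary using (Decidable)
  open import Relation.Binary.PropositionalEquality
    using (_≡_; _≢_; refl; cong; cong₂; sym; trans; subst; module ≡-Reasoning)

  counts : Subset n → Fin 3 → ℕ
  counts B Y = sizeIn (blockSet lab Y) B

  InBox : (Fin 3 → ℕ) → Set
  InBox c = ∀ Y → (ℓ Y ≤ c Y) × (c Y ≤ h Y)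

  BoxBasis : Subset n → Set
  BoxBasis B = (size B ≡ k) × InBox (counts B)

  boxBasis? : Decidable BoxBasis
  boxBasis? B = size B ℕ.≟ k ×-dec all? (λ Y → ℓ Y ℕ.≤? counts B Y ×-dec counts B Y ℕ.≤? h Y)

  size≡Σ₃counts : ∀ B → size B ≡ Σ₃ (counts B)
  size≡Σ₃counts B = count-partition lab (lookup B)

  Σ₃-mono-< : ∀ {g g′ : Fin 3 → ℕ} E → (∀ Y → g Y ≤ g′ Y) → g E < g′ E → Σ₃ g < Σ₃ g′
  Σ₃-mono-< zero g≤g′ gE<g′E = +-mono-<-≤ (+-mono-<-≤ gE<g′E (g≤g′ j₂)) (g≤g′ j₃)
  Σ₃-mono-< (suc zero) g≤g′ gE<g′E = +-mono-<-≤ (+-mono-≤-< (g≤g′ j₁) gE<g′E) (g≤g′ j₃)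
  Σ₃-mono-< (suc (suc zero)) g≤g′ gE<g′E = +-mono-≤-< (+-mono-≤ (g≤g′ j₁) (g≤g′ j₂)) gE<g′E

  size-swap : ∀ (B : Subset n) e f → lookup B e ≡ true → lookup B f ≡ false → size (swap B e f) ≡ size B
  size-swap B e f Bₑ Bf = +-cancelʳ-≡ 1 (size (swap B e f)) (size B) (sizeIn-swap (λ _ → true) B e f Bₑ Bf)

  swap-inBox : ∀ (B : Subset n) e f → lookup B e ≡ true → lookup B f ≡ false → InBox (counts B) →
    (lab e ≢ lab f → ℓ (lab e) < counts B (lab e)) → (lab e ≢ lab f → counts B (lab f) < h (lab f)) →
    InBox (counts (swap B e f))
  swap-inBox B e f Bₑ Bf box roomₑ room-f Y = moved (lab e Fin.≟ Y) (lab f Fin.≟ Y)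
    where
    c = counts B Y
    c′ = counts (swap B e f) Y
    InY : ℕ → Set
    InY x = (ℓ Y ≤ x) × (x ≤ h Y)
    balance : ∀ {a b} → blockSet lab Y e ≡ a → blockSet lab Y f ≡ b → c′ + Bool→ℕ a ≡ c + Bool→ℕ b
    balance refl refl = sizeIn-swap (blockSet lab Y) B e f Bₑ Bf
    moved : Dec (lab e ≡ Y) → Dec (lab f ≡ Y) → InY c′
    moved (yes eY) (yes fY) =
      subst InY (sym (+-cancelʳ-≡ 1 c′ c (balance (blockSet-≡ lab eY) (blockSet-≡ lab fY)))) (box Y)
    moved (no eY) (no fY) =
      subst InY (sym (+-cancelʳ-≡ 0 c′ c (balance (blockSet-≢ lab eY) (blockSet-≢ lab fY)))) (box Y)
    moved (yes eY) (no fY) = m<1+n⇒m≤n (subst (ℓ Y <_) (sym 1+c′≡c) ℓY<c) ,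
                             ≤-trans (n≤1+n c′) (subst (_≤ h Y) (sym 1+c′≡c) (proj₂ (box Y)))
      where
      1+c′≡c : suc c′ ≡ c
      1+c′≡c = trans (+-comm 1 c′) (trans (balance (blockSet-≡ lab eY) (blockSet-≢ lab fY)) (+-identityʳ c))
      ℓY<c : ℓ Y < c
      ℓY<c = subst (λ X → ℓ X < counts B X) eY (roomₑ (λ e≡f → fY (trans (sym e≡f) eY)))
    moved (no eY) (yes fY) = ≤-trans (proj₁ (box Y)) (subst (c ≤_) (sym c′≡1+c) (n≤1+n c)) ,
                             subst (_≤ h Y) (sym c′≡1+c) c<hY
      where
      c′≡1+c : c′ ≡ suc c
      c′≡1+c = trans (sym (+-identityʳ c′)) (trans (balance (blockSet-≢ lab eY) (blockSet-≡ lab fY)) (+-comm c 1))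
      c<hY : c < h Y
      c<hY = subst (λ X → counts B X < h X) fY (room-f (λ e≡f → eY (trans e≡f fY)))

  onlyIn : Subset n → Subset n → Fin 3 → ℕ
  onlyIn B B′ Y = count (λ i → blockSet lab Y i ∧ (lookup B i ∧ not (lookup B′ i)))

  counts-balance : ∀ B₁ B₂ Y → counts B₁ Y + onlyIn B₂ B₁ Y ≡ counts B₂ Y + onlyIn B₁ B₂ Y
  counts-balance B₁ B₂ Y = begin
    counts B₁ Y + onlyIn B₂ B₁ Y              ≡⟨ cong (_+ onlyIn B₂ B₁ Y) (count-split A (lookup B₁) (lookup B₂)) ⟩
    common₁₂ + onlyIn B₁ B₂ Y + onlyIn B₂ B₁ Y ≡⟨ xy∙z≈xz∙y common₁₂ _ _ ⟩
    common₁₂ + onlyIn B₂ B₁ Y + onlyIn B₁ B₂ Y ≡⟨ cong (λ m → m + onlyIn B₂ B₁ Y + onlyIn B₁ B₂ Y) common-comm ⟩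
    common₂₁ + onlyIn B₂ B₁ Y + onlyIn B₁ B₂ Y ≡⟨ cong (_+ onlyIn B₁ B₂ Y) (count-split A (lookup B₂) (lookup B₁)) ⟨
    counts B₂ Y + onlyIn B₁ B₂ Y              ∎
    where
    open ≡-Reasoning
    A = blockSet lab Y
    common₁₂ = count (λ i → A i ∧ (lookup B₁ i ∧ lookup B₂ i))
    common₂₁ = count (λ i → A i ∧ (lookup B₂ i ∧ lookup B₁ i))
    common-comm : common₁₂ ≡ common₂₁
    common-comm = count-cong (λ i → cong (A i ∧_) (BoolP.∧-comm (lookup B₁ i) (lookup B₂ i)))

  counts-≤-if-nothing-new : ∀ B₁ B₂ Y → onlyIn B₂ B₁ Y ≡ 0 → counts B₂ Y ≤ counts B₁ Y
  counts-≤-if-nothing-new B₁ B₂ Y nothing-new = subst (counts B₂ Y ≤_)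
    (sym (trans (sym (+-identityʳ _)) (trans (cong (counts B₁ Y +_) (sym nothing-new)) (counts-balance B₁ B₂ Y))))
    (m≤m+n (counts B₂ Y) (onlyIn B₁ B₂ Y))

  counts-<-if-nothing-new : ∀ B₁ B₂ {e} → lookup B₁ e ≡ true → lookup B₂ e ≡ false →
    onlyIn B₂ B₁ (lab e) ≡ 0 → counts B₂ (lab e) < counts B₁ (lab e)
  counts-<-if-nothing-new B₁ B₂ {e} B₁ₑ B₂ₑ nothing-new = subst (counts B₂ (lab e) <_)
    (sym (trans (sym (+-identityʳ _)) (trans (cong (counts B₁ (lab e) +_) (sym nothing-new)) (counts-balance B₁ B₂ (lab e)))))
    (subst (_≤ counts B₂ (lab e) + onlyIn B₁ B₂ (lab e)) (+-comm (counts B₂ (lab e)) 1)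
       (+-monoʳ-≤ (counts B₂ (lab e)) (count-pos _ e e-only-in-B₁)))
    where
    e-only-in-B₁ : (blockSet lab (lab e) e ∧ (lookup B₁ e ∧ not (lookup B₂ e))) ≡ true
    e-only-in-B₁ rewrite blockSet-≡ lab {lab e} {e} refl | B₁ₑ | B₂ₑ = refl

  new-element : ∀ B₁ B₂ Y → 1 ≤ onlyIn B₂ B₁ Y →
    Σ (Fin n) λ f → (lookup B₂ f ≡ true) × (lookup B₁ f ≡ false) × (lab f ≡ Y)
  new-element B₁ B₂ Y new with count-witness _ new
  ... | f , inside with blockSet lab Y f in A_f | lookup B₂ f in B₂f | lookup B₁ f in B₁f
  ...   | true | true | false = f , B₂f , B₁f , blockSet-true lab A_f

  -- If no block Y can take the new element f, then |B₂ ∩ A_Y| ≤ |B₁ ∩ A_Y| for every Y, strictly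
  -- for Y = lab e, contradicting |B₁| = |B₂|.
  boxBasis-exchange : SymmetricExchange BoxBasis
  boxBasis-exchange B₁ B₂ (size₁ , box₁) (size₂ , box₂) e B₁ₑ B₂ₑ with 1 ℕ.≤? onlyIn B₂ B₁ (lab e)
  ... | yes new with new-element B₁ B₂ (lab e) new
  ...   | f , B₂f , B₁f , labf≡labe =
    f , B₂f , B₁f ,
    (trans (size-swap B₁ e f B₁ₑ B₁f) size₁ ,
     swap-inBox B₁ e f B₁ₑ B₁f box₁ (λ e≢f → ⊥-elim (e≢f (sym labf≡labe))) (λ e≢f → ⊥-elim (e≢f (sym labf≡labe)))) ,
    (trans (size-swap B₂ f e B₂f B₂ₑ) size₂ ,
     swap-inBox B₂ f e B₂f B₂ₑ box₂ (λ f≢e → ⊥-elim (f≢e labf≡labe)) (λ f≢e → ⊥-elim (f≢e labf≡labe)))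
  boxBasis-exchange B₁ B₂ (size₁ , box₁) (size₂ , box₂) e B₁ₑ B₂ₑ | no nothing-new
    with any? (λ Y → 1 ℕ.≤? onlyIn B₂ B₁ Y ×-dec counts B₁ Y ℕ.<? h Y ×-dec ℓ Y ℕ.<? counts B₂ Y)
  ... | yes (Y , new , room₁ , room₂) with new-element B₁ B₂ Y new
  ...   | f , B₂f , B₁f , labf≡Y =
    f , B₂f , B₁f ,
    (trans (size-swap B₁ e f B₁ₑ B₁f) size₁ ,
     swap-inBox B₁ e f B₁ₑ B₁f box₁ (λ _ → ≤-<-trans (proj₁ (box₂ (lab e))) c₂<c₁)
                                     (λ _ → subst (λ X → counts B₁ X < h X) (sym labf≡Y) room₁)) ,
    (trans (size-swap B₂ f e B₂f B₂ₑ) size₂ ,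
     swap-inBox B₂ f e B₂f B₂ₑ box₂ (λ _ → subst (λ X → ℓ X < counts B₂ X) (sym labf≡Y) room₂)
                                     (λ _ → <-≤-trans c₂<c₁ (proj₂ (box₁ (lab e)))))
    where
    c₂<c₁ = counts-<-if-nothing-new B₁ B₂ B₁ₑ B₂ₑ (n<1⇒n≡0 (≰⇒> nothing-new))
  boxBasis-exchange B₁ B₂ (size₁ , box₁) (size₂ , box₂) e B₁ₑ B₂ₑ | no nothing-new | no no-room =
    ⊥-elim (<-irrefl Σ₂≡Σ₁ (Σ₃-mono-< (lab e) dominated c₂<c₁))
    where
    c₂<c₁ = counts-<-if-nothing-new B₁ B₂ B₁ₑ B₂ₑ (n<1⇒n≡0 (≰⇒> nothing-new))
    Σ₂≡Σ₁ : Σ₃ (counts B₂) ≡ Σ₃ (counts B₁)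
    Σ₂≡Σ₁ = trans (sym (size≡Σ₃counts B₂)) (trans size₂ (trans (sym size₁) (size≡Σ₃counts B₁)))
    dominated : ∀ Y → counts B₂ Y ≤ counts B₁ Y
    dominated Y with 1 ℕ.≤? onlyIn B₂ B₁ Y | counts B₁ Y ℕ.<? h Y | ℓ Y ℕ.<? counts B₂ Y
    ... | no none | _ | _ = counts-≤-if-nothing-new B₁ B₂ Y (n<1⇒n≡0 (≰⇒> none))
    ... | yes _ | no full | _ = ≤-trans (proj₂ (box₂ Y)) (≮⇒≥ full)
    ... | yes _ | yes _ | no empty = ≤-trans (≮⇒≥ empty) (proj₁ (box₁ Y))
    ... | yes new | yes room₁ | yes room₂ = ⊥-elim (no-room (Y , new , room₁ , room₂))

  boxBasis-exists : ∀ (q : Fin 3 → ℕ) → Σ₃ q ≡ k → InBox q → (∀ Y → q Y ≤ blockSize lab Y) → ∃ BoxBasis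
  boxBasis-exists q Σq≡k box q≤size =
    quotaSet lab q ,
    trans (size≡Σ₃counts (quotaSet lab q)) (trans (cong₂ _+_ (cong₂ _+_ (counts≡q j₁) (counts≡q j₂)) (counts≡q j₃)) Σq≡k) ,
    λ Y → subst (λ m → (ℓ Y ≤ m) × (m ≤ h Y)) (sym (counts≡q Y)) (box Y)
    where
    counts≡q : ∀ Y → counts (quotaSet lab q) Y ≡ q Y
    counts≡q = sizeIn-quotaSet lab q q≤size

module BoxCells {n} (k : ℕ) (lab : Fin n → Fin 3) (ℓ h : Fin 3 → ℕ) where

  open ℕ→ℚ-Properties
  open FiniteSums
  open SubsetCounting
  open ConvexHulls
  open MatroidFaces
  open BoxBases k lab ℓ h
  open import Data.Nat as ℕ using (suc; z≤n)
  open import Data.Bool using (true)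
  open import Data.Nat.Coprimality using (1-coprimeTo)
  open import Data.Integer using (+_)
  open import Data.Rational as ℚ using (ℚ; mkℚ; 1ℚ; _*_; _≤_)
  import Data.Rational.Properties as ℚP
  open import Data.Rational.Solver using (module +-*-Solver)
  open import Data.Product using (_×_; _,_; proj₁; proj₂)
  open import Data.Vec using (lookup)
  import Data.Nat.Properties as ℕP
  open import Algebra.Properties.Semiring.Sum ℕP.+-*-semiring using (sum)
  open import Relation.Binary.PropositionalEquality
    using (_≡_; refl; cong; sym; trans; subst; subst₂; module ≡-Reasoning)
  open +-*-Solver using (solve; _:*_; _:=_)

  BoxCell : Point n → Set
  BoxCell x = InHypersimplex k n x ×
    (∀ Y → (ℕ→ℚ (ℓ Y) ≤ sumOver (blockSet lab Y) x) × (sumOver (blockSet lab Y) x ≤ ℕ→ℚ (h Y)))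

  hull⇒boxCell : ∀ {x} → InHull BoxBasis x → BoxCell x
  hull⇒boxCell hull =
    (hull-unit-interval hull ,
     ℚP.≤-antisym (hull-sumOver-≤ (λ _ → true) k (λ (size≡k , _) → ℕP.≤-reflexive size≡k) hull)
                  (hull-sumOver-≥ (λ _ → true) k (λ (size≡k , _) → ℕP.≤-reflexive (sym size≡k)) hull)) ,
    λ Y → hull-sumOver-≥ (blockSet lab Y) (ℓ Y) (λ (_ , box) → proj₁ (box Y)) hull ,
          hull-sumOver-≤ (blockSet lab Y) (h Y) (λ (_ , box) → proj₂ (box Y)) hull

  layer-boxBasis : ∀ D-1 (y : Fin n → ℕ) (y≤D : ∀ i → y i ℕ.≤ suc D-1) → let open Rounding D-1 in
    sum y ≡ k ℕ.* D → (∀ Y → (ℓ Y ℕ.* D ℕ.≤ blockSum lab y Y) × (blockSum lab y Y ℕ.≤ h Y ℕ.* D)) →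
    ∀ r → BoxBasis (Layers.layer lab y y≤D r)
  layer-boxBasis D-1 y y≤D sum-y blockSums r =
    trans (size-layer r) (trans (cong (residueCount r 0) sum-y) (residueCount-multiple r 0 k)) ,
    λ Y → subst (λ m → (ℓ Y ℕ.≤ m) × (m ℕ.≤ h Y)) (sym (sizeIn-layer r Y))
                (residueCount-≥ r (offset Y) _ (ℓ Y) (proj₁ (blockSums Y)) ,
                 residueCount-≤ r (offset Y) _ (h Y) (proj₂ (blockSums Y)))
    where
    open Rounding D-1
    open Layers lab y y≤D

  boxCell⇒positiveHull : ∀ {x} → BoxCell x → InPositiveHull BoxBasis x
  boxCell⇒positiveHull {x} ((unit , Σx≡k) , bounds) with clearDenominators x (λ i → proj₁ (unit i))
  ... | D-1 , y , xD≡y =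
    uniform 1/D layer , AllTerms-uniform 1/D layer (λ r → ℚP.positive⁻¹ 1/D , layer-boxBasis D-1 y y≤D sum-y blockSums r) ,
    trans (coeffSum-uniform 1/D layer) 1/D*D≡1 , combo≡x
    where
    open Rounding D-1
    d = ℕ→ℚ D
    instance
      d-nonNegative : ℚ.NonNegative d
      d-nonNegative = ℚ.nonNegative (ℕ→ℚ-mono-≤ {0} {D} z≤n)
    y≤D : ∀ i → y i ℕ.≤ D
    y≤D i = ℕ→ℚ-cancel-≤ (subst₂ _≤_ (xD≡y i) (ℚP.*-identityˡ d) (ℚP.*-monoʳ-≤-nonNeg d (proj₂ (unit i))))
    open Rounding.Layers D-1 lab y y≤D using (layer; sum-layer)
    scaled : ∀ A → sumOver A x * d ≡ ℕ→ℚ (sum (restrict A y))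
    scaled A = sumOver-scale A x d y xD≡y
    sum-y : sum y ≡ k ℕ.* D
    sum-y = ℕ→ℚ-injective (trans (sym (scaled (λ _ → true))) (trans (cong (_* d) Σx≡k) (sym (ℕ→ℚ-homo-* k D))))
    blockSums : ∀ Y → (ℓ Y ℕ.* D ℕ.≤ blockSum lab y Y) × (blockSum lab y Y ℕ.≤ h Y ℕ.* D)
    blockSums Y =
      ℕ→ℚ-cancel-≤ (subst₂ _≤_ (sym (ℕ→ℚ-homo-* (ℓ Y) D)) (scaled (blockSet lab Y))
                               (ℚP.*-monoʳ-≤-nonNeg d (proj₁ (bounds Y)))) ,
      ℕ→ℚ-cancel-≤ (subst₂ _≤_ (scaled (blockSet lab Y)) (sym (ℕ→ℚ-homo-* (h Y) D))
                               (ℚP.*-monoʳ-≤-nonNeg d (proj₂ (bounds Y))))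
    1/D : ℚ
    1/D = mkℚ (+ 1) D-1 (1-coprimeTo D)
    1/D*D≡1 : 1/D * d ≡ 1ℚ
    1/D*D≡1 = mkℚ-*-denominator 1 D-1 (1-coprimeTo D)
    combo≡x : ∀ i → combo (uniform 1/D layer) i ≡ x i
    combo≡x i = begin
      combo (uniform 1/D layer) i ≡⟨ combo-uniform 1/D layer i ⟩
      1/D * ℕ→ℚ (sum (λ r → Bool→ℕ (lookup (layer r) i))) ≡⟨ cong (λ m → 1/D * ℕ→ℚ m) (sum-layer i) ⟩
      1/D * ℕ→ℚ (y i)   ≡⟨ cong (1/D *_) (xD≡y i) ⟨
      1/D * (x i * d)   ≡⟨ solve 3 (λ c x d → c :* (x :* d) := x :* (c :* d)) refl 1/D (x i) d ⟩
      x i * (1/D * d)   ≡⟨ cong (x i *_) 1/D*D≡1 ⟩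
      x i * 1ℚ          ≡⟨ ℚP.*-identityʳ (x i) ⟩
      x i               ∎
      where open ≡-Reasoning

  boxCell-faces : (q : Fin 3 → ℕ) → Σ₃ q ≡ k → InBox q → (∀ Y → q Y ℕ.≤ blockSize lab Y) →
    (c : Point n) → IsMatroidPolytope (face BoxCell c)
  boxCell-faces q Σq≡k box q≤size =
    FaceMatroid.faces-are-matroid-polytopes boxBasis? (boxBasis-exists q Σq≡k box q≤size) boxBasis-exchange
      BoxCell boxCell⇒positiveHull hull⇒boxCell

module ThreeSplitCells {n} (k : ℕ) (lab : Fin n → Fin 3) (μ : Fin 3 → ℕ) where

  open import Data.Nat as ℕ using (ℕ; _≤_)
  import Data.Nat.Properties as ℕP
  open import Data.Bool using (Bool; true; false; if_then_else_)
  import Data.Rational as ℚ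
  open import Data.Fin as Fin using (Fin; zero; suc)
  open import Data.Product using (_×_; _,_; proj₁; proj₂)
  open import Data.Empty using (⊥-elim)
  open import Function using (_⇔_; mk⇔)
  open import Relation.Nullary using (yes; no)
  open import Relation.Nullary.Decidable using (⌊_⌋)
  open import Relation.Binary.PropositionalEquality using (_≡_; _≢_; refl; cong; sym; trans; subst)
  open ℕ→ℚ-Properties
  open FiniteSums

  -- A cell bounds one block U from above and another block W from below; the remaining
  -- bounds 0 and k hold on all of Δ(k,n).
  lowerBounds : Fin 3 → Fin 3 → ℕ
  lowerBounds W Y = if ⌊ W Fin.≟ Y ⌋ then μ W else 0

  upperBounds : Fin 3 → Fin 3 → ℕ
  upperBounds U Y = if ⌊ U Fin.≟ Y ⌋ then μ U else k

  Halfspaces : Fin 3 → Fin 3 → Point n → Set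
  Halfspaces U W x =
    InHypersimplex k n x × (sumOver (blockSet lab U) x ℚ.≤ ℕ→ℚ (μ U)) × (ℕ→ℚ (μ W) ℚ.≤ sumOver (blockSet lab W) x)

  open BoxCells {n} k lab

  halfspaces⇔boxCell : ∀ {U W} → U ≢ W → ∀ x → Halfspaces U W x ⇔ BoxCell (lowerBounds W) (upperBounds U) x
  halfspaces⇔boxCell {U} {W} U≢W x = mk⇔
    (λ (Δx , upper , lower) → Δx , bounds Δx upper lower)
    (λ (Δx , bounds) → Δx , subst (λ m → sumOver (blockSet lab U) x ℚ.≤ ℕ→ℚ m) upper-at-U (proj₂ (bounds U)) ,
                            subst (λ m → ℕ→ℚ m ℚ.≤ sumOver (blockSet lab W) x) lower-at-W (proj₁ (bounds W)))
    where
    upper-at-U : upperBounds U U ≡ μ U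
    upper-at-U with U Fin.≟ U
    ... | yes _ = refl
    ... | no U≢U = ⊥-elim (U≢U refl)
    lower-at-W : lowerBounds W W ≡ μ W
    lower-at-W with W Fin.≟ W
    ... | yes _ = refl
    ... | no W≢W = ⊥-elim (W≢W refl)
    trivial-bounds : InHypersimplex k n x → ∀ Y →
      (ℕ→ℚ 0 ℚ.≤ sumOver (blockSet lab Y) x) × (sumOver (blockSet lab Y) x ℚ.≤ ℕ→ℚ k)
    trivial-bounds (unit , Σx≡k) Y =
      sumOver-nonNegative (blockSet lab Y) (λ i → proj₁ (unit i)) ,
      subst (sumOver (blockSet lab Y) x ℚ.≤_) Σx≡k (sumOver-≤-sumFin (blockSet lab Y) (λ i → proj₁ (unit i)))
    bounds : InHypersimplex k n x → sumOver (blockSet lab U) x ℚ.≤ ℕ→ℚ (μ U) → ℕ→ℚ (μ W) ℚ.≤ sumOver (blockSet lab W) x →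
      ∀ Y → (ℕ→ℚ (lowerBounds W Y) ℚ.≤ sumOver (blockSet lab Y) x) × (sumOver (blockSet lab Y) x ℚ.≤ ℕ→ℚ (upperBounds U Y))
    bounds Δx upper lower Y with U Fin.≟ Y | W Fin.≟ Y
    ... | yes U≡Y | yes W≡Y = ⊥-elim (U≢W (trans U≡Y (sym W≡Y)))
    ... | yes U≡Y | no _ = proj₁ (trivial-bounds Δx Y) , subst (λ Z → sumOver (blockSet lab Z) x ℚ.≤ ℕ→ℚ (μ U)) U≡Y upper
    ... | no _ | yes W≡Y = subst (λ Z → ℕ→ℚ (μ W) ℚ.≤ sumOver (blockSet lab Z) x) W≡Y lower , proj₂ (trivial-bounds Δx Y)
    ... | no _ | no _ = trivial-bounds Δx Y

  upperBlock lowerBlock : Bool → Fin 3 → Fin 3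
  upperBlock false = prevIdx
  upperBlock true = nextIdx
  lowerBlock false = nextIdx
  lowerBlock true = prevIdx

  upperBlock≢lowerBlock : ∀ flipped j → upperBlock flipped j ≢ lowerBlock flipped j
  upperBlock≢lowerBlock false zero = λ ()
  upperBlock≢lowerBlock false (suc zero) = λ ()
  upperBlock≢lowerBlock false (suc (suc zero)) = λ ()
  upperBlock≢lowerBlock true zero = λ ()
  upperBlock≢lowerBlock true (suc zero) = λ ()
  upperBlock≢lowerBlock true (suc (suc zero)) = λ ()

  cell⇔halfspaces : ∀ flipped j x → cell k n lab μ flipped j x ⇔ Halfspaces (upperBlock flipped j) (lowerBlock flipped j) x
  cell⇔halfspaces false j x = mk⇔ (λ inCell → inCell) (λ inCell → inCell)
  cell⇔halfspaces true j x =
    mk⇔ (λ (Δx , lower , upper) → Δx , upper , lower) (λ (Δx , upper , lower) → Δx , lower , upper)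

  μ≤Σ₃μ : ∀ Y → μ Y ≤ Σ₃ μ
  μ≤Σ₃μ zero = ℕP.≤-trans (ℕP.m≤m+n (μ j₁) (μ j₂)) (ℕP.m≤m+n _ (μ j₃))
  μ≤Σ₃μ (suc zero) = ℕP.≤-trans (ℕP.m≤n+m (μ j₂) (μ j₁)) (ℕP.m≤m+n _ (μ j₃))
  μ≤Σ₃μ (suc (suc zero)) = ℕP.m≤n+m (μ j₃) _

  μ-inBox : Σ₃ μ ≡ k → ∀ U W → BoxBases.InBox k lab (lowerBounds W) (upperBounds U) μ
  μ-inBox Σμ≡k U W Y with W Fin.≟ Y | U Fin.≟ Y
  ... | yes W≡Y | yes U≡Y = ℕP.≤-reflexive (cong μ W≡Y) , ℕP.≤-reflexive (cong μ (sym U≡Y))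
  ... | yes W≡Y | no _ = ℕP.≤-reflexive (cong μ W≡Y) , subst (μ Y ≤_) Σμ≡k (μ≤Σ₃μ Y)
  ... | no _ | yes U≡Y = ℕ.z≤n , ℕP.≤-reflexive (cong μ (sym U≡Y))
  ... | no _ | no _ = ℕ.z≤n , subst (μ Y ≤_) Σμ≡k (μ≤Σ₃μ Y)

open import Data.Nat using (_+_; _≤_; _<_)
open import Data.Nat.Properties using (≤-trans; m≤m+n)
open import Data.Bool using (Bool)
open import Function.Construct.Composition using (_⇔-∘_)
open import Relation.Binary.PropositionalEquality using (_≡_)
open MatroidFaces using (face-resp-⇔)

theorem6p5 : (k n : ℕ) → 1 ≤ k → k < n →
    (lab : Fin n → Fin 3) → (μ : Fin 3 → ℕ) →
    μ j₁ + μ j₂ + μ j₃ ≡ k →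
    ((j : Fin 3) → 1 ≤ μ j) →
    ((j : Fin 3) → μ j + 1 ≤ blockSize lab j) →
    (flipped : Bool) → (j : Fin 3) → (c : Point n) →
    IsMatroidPolytope (face (cell k n lab μ flipped j) c)
-- The hypotheses 1 ≤ k < n, 1 ≤ μ j and μ j < |A_j| make the cells a genuine 3-split;
-- matroidality only needs μ j ≤ |A_j|.
theorem6p5 k n _ _ lab μ Σμ≡k _ μ<size flipped j c =
  face-resp-⇔ c (λ x → halfspaces⇔boxCell (upperBlock≢lowerBlock flipped j) x ⇔-∘ cell⇔halfspaces flipped j x)
    (boxCell-faces (lowerBounds W) (upperBounds U) μ Σμ≡k (μ-inBox Σμ≡k U W)
                   (λ Y → ≤-trans (m≤m+n (μ Y) 1) (μ<size Y)) c)
  where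
  open ThreeSplitCells k lab μ
  open BoxCells k lab
  U = upperBlock flipped j
  W = lowerBlock flipped j
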